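{- Consider the octal game $\mathbf{0.26}$ in mis\`ere play. Let $\mathscr{A}$ be the free commutative monoid on the heaps $H_1,H_2,H_3,\ldots$, so that every position is a finite sum $G=\sum_k m_k H_k$. Let $\mathcal{Q}$ be the commutative monoid with presentation \[\mathcal{Q}=\langle a,\,b,\,c_0,c_1,c_2,\ldots \mid a^2=1,\ \ b^{n+1}c_n=b^{2n+3}\ (n\ge 0),\ \ c_mc_n=b^{m+2}c_n\ (0\le m\le n)\rangle,\] and let $\mathcal{P}=\{a\}\cup\{b^{2m}: m\ge 1\}\cup\{b^mc_n : 0\le m\le n,\ m+n \text{ odd}\}\subseteq\mathcal{Q}$. Let $\Phi:\mathscr{A}\to\mathcal{Q}$ be the monoid homomorphism determined by $\Phi(H_1)=\Phi(H_5)=1$, $\Phi(H_2)=\Phi(H_6)=a$, $\Phi(H_3)=\Phi(H_7)=b$, $\Phi(H_4)=\Phi(H_8)=ab$, $\Phi(H_9)=c_0$, $\Phi(H_{10})=ac_0$, $\Phi(H_k)=c_{(k-9)/2}$ for odd $k\ge 11$, and $\Phi(H_k)=ab\,c_{(k-12)/2}$ for even $k\ge 12$. Then for every position $G\in\mathscr{A}$, $G$ is a mis\`ere $\mathscr{P}$-position if and only if $\Phi(G)\in\mathcal{P}$.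
   Context: The octal game $\mathbf{0.26}$ is played on a disjunctive sum of heaps of beans; a move consists of choosing one heap and either (i) removing exactly 1 bean from it, provided the heap that remains is nonempty (so the heap is replaced by one nonempty heap), or (ii) removing exactly 2 beans from it and leaving the remainder as either one nonempty heap or split into two nonempty heaps. Removing an entire heap is never allowed. $H_k$ denotes a single heap of $k$ beans. In mis\`ere play, the player who makes the last move loses. A position is a mis\`ere $\mathscr{P}$-position if the player about to move loses with perfect play; recursively, $G$ is a $\mathscr{P}$-position iff $G$ has at least one option and every option of $G$ is not a $\mathscr{P}$-position (a position with no moves is therefore not a $\mathscr{P}$-position). -}

module Defs where

open import Data.Nat using (ℕ; zero; suc; _+_; _*_; _∸_; _≤_; _≡ᵇ_)
open import Data.Nat.DivMod using (_/_; _%_)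
open import Data.Bool using (if_then_else_)
open import Data.List using (List; []; _∷_; _++_; concatMap)
open import Data.Product using (Σ; ∃; ∃-syntax; _×_; _,_)
open import Data.Sum using (_⊎_)
open import Data.Empty using (⊥)
open import Relation.Binary.PropositionalEquality using (_≡_)

-- Positions of 0.26: a position is a finite sum of heaps, represented as
-- a list of heap sizes (order irrelevant for play).  Heaps are nonempty.

Position : Set
Position = List ℕ

data HeapMove : ℕ → List ℕ → Set where
  take1      : ∀ r → HeapMove (suc (suc r)) (suc r ∷ [])
  take2      : ∀ r → HeapMove (suc (suc (suc r))) (suc r ∷ [])
  take2split : ∀ a b → HeapMove (2 + (suc a + suc b)) (suc a ∷ suc b ∷ [])

data Move : Position → Position → Set where
  here  : ∀ {k hs G} → HeapMove k hs → Move (k ∷ G) (hs ++ G)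
  there : ∀ {k G G'} → Move G G' → Move (k ∷ G) (k ∷ G')

-- Misère P-positions (recursive definition; the game is short, so this
-- mutual inductive definition realises "G is P iff G has an option and
-- every option of G is not P", with IsN = "not P").
mutual
  data IsP : Position → Set where
    isP : ∀ {G} → (∃[ G' ] Move G G') → (∀ {G'} → Move G G' → IsN G') → IsP G

  data IsN : Position → Set where
    noMove : ∀ {G} → (∀ {G'} → Move G G' → ⊥) → IsN G
    toP    : ∀ {G G'} → Move G G' → IsP G' → IsN G

data Gen : Set where
  ga : Gen
  gb : Gen
  gc : ℕ → Gen

Word : Set
Word = List Gen

bpow : ℕ → Word
bpow zero    = []
bpow (suc n) = gb ∷ bpow n

infix 4 _≈_
data _≈_ : Word → Word → Set where
  ≈-refl  : ∀ {u} → u ≈ u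
  ≈-sym   : ∀ {u v} → u ≈ v → v ≈ u
  ≈-trans : ∀ {u v w} → u ≈ v → v ≈ w → u ≈ w
  ≈-cong  : ∀ {u u' v v'} → u ≈ u' → v ≈ v' → u ++ v ≈ u' ++ v'
  ≈-comm  : ∀ u v → u ++ v ≈ v ++ u
  rel-a   : ga ∷ ga ∷ [] ≈ []
  rel-bc  : ∀ n → bpow (n + 1) ++ (gc n ∷ []) ≈ bpow (2 * n + 3)
  rel-cc  : ∀ m n → m ≤ n → gc m ∷ gc n ∷ [] ≈ bpow (m + 2) ++ (gc n ∷ [])

InPSet : Word → Set
InPSet w =
  (w ≈ ga ∷ [])
  ⊎ (∃[ m ] (1 ≤ m × w ≈ bpow (2 * m)))
  ⊎ (∃[ m ] ∃[ n ] (m ≤ n × (m + n) % 2 ≡ 1 × w ≈ bpow m ++ (gc n ∷ [])))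

Φheap : ℕ → Word
Φheap 1  = []
Φheap 2  = ga ∷ []
Φheap 3  = gb ∷ []
Φheap 4  = ga ∷ gb ∷ []
Φheap 5  = []
Φheap 6  = ga ∷ []
Φheap 7  = gb ∷ []
Φheap 8  = ga ∷ gb ∷ []
Φheap 9  = gc 0 ∷ []
Φheap 10 = ga ∷ gc 0 ∷ []
Φheap k  = if k % 2 ≡ᵇ 1
           then gc ((k ∸ 9) / 2) ∷ []
           else ga ∷ gb ∷ gc ((k ∸ 12) / 2) ∷ []
-- (Φheap 0 is irrelevant: heaps are nonempty.)

Φ : Position → Word
Φ G = concatMap Φheap G

-- Every element of Q is described, modulo the relations, by three numbers: the parity of the exponent
-- of a, the b-degree d, in which c_n counts as n + 2, and the largest n for which a factor c_n survives;
-- b^(n+1) c_n = b^(2n+3) absorbs c_n as soon as d > 2(n+1), and c_m c_n = b^(m+2) c_n keeps only the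
-- largest index. Membership in 𝒫 is a condition on these numbers, and Φ turns every position into
-- such a value. The theorem follows by induction on the number of beans from two facts about values:
-- no move leads from a 𝒫-value to a 𝒫-value, and every other position that has a move has one into
-- 𝒫, obtained by flipping the parity of a with a one-bean move on an a-heap or by a case analysis
-- on the heap carrying the largest c-index.
module Submission where

open import Defs
open import Data.Bool using (Bool; true; false; not; _xor_; if_then_else_; T)
open import Data.Bool.Properties
  using (xor-assoc; xor-comm; xor-identityʳ; not-distribˡ-xor; not-involutive; not-injective; not-¬)
  renaming (_≟_ to _≟ᵇ_)
open import Data.Empty using (⊥; ⊥-elim)
open import Data.List using (List; []; _∷_; _++_)
open import Data.List.Properties using (++-assoc; ++-identityʳ)
open import Data.List.Relation.Unary.All using (All; []; _∷_)
import Data.List.Relation.Unary.All.Properties as All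
open import Data.Nat using (ℕ; zero; suc; pred; >-nonZero; _+_; _*_; _∸_; _≤_; _<_; z≤n; s≤s; _⊔_; _≤?_; _<?_; _≟_; _≤ᵇ_)
open import Data.Nat.DivMod using (_/_; _%_; [m+n]%n≡m%n; [m+kn]%n≡m%n; m*n%n≡0; m*n/n≡m)
open import Data.Nat.ListAction using (sum)
open import Data.Nat.ListAction.Properties using (sum-++)
open import Data.Nat.Properties
open import Data.Nat.Tactic.RingSolver using (solve-∀)
open import Data.Product using (Σ; ∃-syntax; _×_; _,_; proj₁; proj₂)
open import Data.Sum using (_⊎_; inj₁; inj₂)
open import Data.Unit using (tt; ⊤)
open import Function.Base using (_∘_)
open import Function.Bundles using (_⇔_; mk⇔)
import Function.Properties.Equivalence as ⇔
open import Relation.Binary.Bundles using (Setoid)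
open import Relation.Binary.PropositionalEquality
  using (_≡_; _≢_; refl; sym; trans; cong; cong₂; subst; subst₂; module ≡-Reasoning)
import Relation.Binary.Reasoning.Setoid as SetoidReasoning
open import Relation.Nullary using (¬_; Dec; yes; no)
open import Relation.Nullary.Decidable using (_×-dec_; _⊎-dec_; toWitness; toWitnessFalse)

odd : ℕ → Bool
odd zero = false
odd (suc zero) = true
odd (suc (suc n)) = odd n

odd-suc : ∀ n → odd (suc n) ≡ not (odd n)
odd-suc zero = refl
odd-suc (suc zero) = refl
odd-suc (suc (suc n)) = odd-suc n

odd-+ : ∀ m n → odd (m + n) ≡ odd m xor odd n
odd-+ zero n = refl
odd-+ (suc zero) n = odd-suc n
odd-+ (suc (suc m)) n = odd-+ m n

odd-pred : ∀ n {b} → odd (suc n) ≡ b → odd n ≡ not b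
odd-pred n {b} eq = begin
  odd n             ≡⟨ not-involutive (odd n) ⟨
  not (not (odd n)) ≡⟨ cong not (odd-suc n) ⟨
  not (odd (suc n)) ≡⟨ cong not eq ⟩
  not b             ∎
  where open ≡-Reasoning

odd≢odd-suc : ∀ n → odd n ≢ odd (suc n)
odd≢odd-suc n eq = not-¬ (trans eq (odd-suc n)) (sym (not-involutive (odd n)))

double : ℕ → ℕ
double zero = zero
double (suc n) = suc (suc (double n))

odd-double : ∀ n → odd (double n) ≡ false
odd-double zero = refl
odd-double (suc n) = odd-double n

double≡+ : ∀ n → double n ≡ n + n
double≡+ zero = refl
double≡+ (suc n) = cong suc (trans (cong suc (double≡+ n)) (sym (+-suc n n)))

double≡2* : ∀ n → double n ≡ 2 * n
double≡2* n = trans (double≡+ n) (cong (n +_) (sym (+-identityʳ n)))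

n+[2+n]≡double[1+n] : ∀ n → n + suc (suc n) ≡ double (suc n)
n+[2+n]≡double[1+n] n = trans (+-suc n (suc n)) (cong suc (trans (+-suc n n) (cong suc (sym (double≡+ n)))))

double-mono : ∀ {m n} → m ≤ n → double m ≤ double n
double-mono z≤n = z≤n
double-mono (s≤s le) = s≤s (s≤s (double-mono le))

n≤double : ∀ n → n ≤ double n
n≤double n = subst (n ≤_) (sym (double≡+ n)) (m≤m+n n n)

odd≤double⇒< : ∀ d m → odd d ≡ true → d ≤ double m → d < double m
odd≤double⇒< d m od le with m≤n⇒m<n∨m≡n le
... | inj₁ lt = lt
... | inj₂ refl with trans (sym od) (odd-double m)
... | ()

even>double⇒2+≤ : ∀ d m → odd d ≡ false → double m < d → 2 + double m ≤ d
even>double⇒2+≤ d m ev lt with m≤n⇒m<n∨m≡n lt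
... | inj₁ lt' = lt'
... | inj₂ refl with trans (sym ev) (trans (odd-suc (double m)) (cong not (odd-double m)))
... | ()

n+0≢suc-double : ∀ n → n + 0 ≢ suc (double n)
n+0≢suc-double n eq = <-irrefl eq (s≤s (subst (_≤ double n) (sym (+-identityʳ n)) (n≤double n)))

2+n≡double[1+n]⇒n≡0 : ∀ n → 2 + n + 0 ≡ double (suc n) → n ≡ 0
2+n≡double[1+n]⇒n≡0 zero eq = refl
2+n≡double[1+n]⇒n≡0 (suc n) eq = ⊥-elim (n+0≢suc-double n (suc-injective (suc-injective (suc-injective eq))))

3+n≡double[1+n]⇒n≡1 : ∀ n → 3 + n + 0 ≡ double (suc n) → n ≡ 1
3+n≡double[1+n]⇒n≡1 zero ()
3+n≡double[1+n]⇒n≡1 (suc zero) eq = refl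
3+n≡double[1+n]⇒n≡1 (suc (suc n)) eq = ⊥-elim (n+0≢suc-double n (suc-injective (suc-injective (suc-injective (suc-injective (suc-injective eq))))))

even≢0⇒2≤ : ∀ d → d ≢ 0 → odd d ≡ false → 2 ≤ d
even≢0⇒2≤ zero d≢0 _ = ⊥-elim (d≢0 refl)
even≢0⇒2≤ (suc zero) _ ()
even≢0⇒2≤ (suc (suc d)) _ _ = s≤s (s≤s z≤n)

even⇒double : ∀ d → odd d ≡ false → ∃[ h ] d ≡ double h
even⇒double zero _ = 0 , refl
even⇒double (suc zero) ()
even⇒double (suc (suc d)) ev with even⇒double d ev
... | h , eq = suc h , cong (λ z → suc (suc z)) eq

double⊎suc-double : ∀ j → (∃[ n ] j ≡ double n) ⊎ (∃[ n ] j ≡ suc (double n))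
double⊎suc-double zero = inj₁ (0 , refl)
double⊎suc-double (suc j) with double⊎suc-double j
... | inj₁ (n , eq) = inj₂ (n , cong suc eq)
... | inj₂ (n , eq) = inj₁ (suc n , cong suc eq)

%2≡if-odd : ∀ k → k % 2 ≡ (if odd k then 1 else 0)
%2≡if-odd zero = refl
%2≡if-odd (suc zero) = refl
%2≡if-odd (suc (suc k)) = trans (cong (_% 2) (+-comm 2 k)) (trans ([m+n]%n≡m%n k 2) (%2≡if-odd k))

%2≡1⇒odd : ∀ k → k % 2 ≡ 1 → odd k ≡ true
%2≡1⇒odd k eq with odd k | %2≡if-odd k
... | true | _ = refl
... | false | e with trans (sym eq) e
...   | ()

odd⇒%2≡1 : ∀ k → odd k ≡ true → k % 2 ≡ 1
odd⇒%2≡1 k od = trans (%2≡if-odd k) (cong (λ b → if b then 1 else 0) od)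

double≡*2 : ∀ n → double n ≡ n * 2
double≡*2 n = trans (double≡2* n) (*-comm 2 n)

double%2≡0 : ∀ n → double n % 2 ≡ 0
double%2≡0 n = trans (cong (_% 2) (double≡*2 n)) (m*n%n≡0 n 2)

suc-double%2≡1 : ∀ n → suc (double n) % 2 ≡ 1
suc-double%2≡1 n = trans (cong (λ k → suc k % 2) (double≡*2 n)) ([m+kn]%n≡m%n 1 n 2)

double/2≡n : ∀ n → double n / 2 ≡ n
double/2≡n n = trans (cong (_/ 2) (double≡*2 n)) (m*n/n≡m n 2)

not-xor-not : ∀ x y → not x xor not y ≡ x xor y
not-xor-not true true = refl
not-xor-not true false = refl
not-xor-not false true = refl
not-xor-not false false = refl

bool-cases : ∀ {A : Set} (b : Bool) → (b ≡ false → A) → (b ≡ true → A) → A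
bool-cases false f t = f refl
bool-cases true f t = t refl

dec-cases : ∀ {A B : Set} → Dec A → (A → B) → (¬ A → B) → B
dec-cases (yes a) f g = f a
dec-cases (no a) f g = g a

m⊔n≡0⇒n≡0 : ∀ m n → m ⊔ n ≡ 0 → n ≡ 0
m⊔n≡0⇒n≡0 zero n eq = eq
m⊔n≡0⇒n≡0 (suc m) zero eq = refl
m⊔n≡0⇒n≡0 (suc m) (suc n) ()

m⊔n≡0⇒m≡0 : ∀ m n → m ⊔ n ≡ 0 → m ≡ 0
m⊔n≡0⇒m≡0 zero n eq = refl
m⊔n≡0⇒m≡0 (suc m) zero ()
m⊔n≡0⇒m≡0 (suc m) (suc n) ()

[1+m]⊔n≤1+[m⊔n] : ∀ m n → suc m ⊔ n ≤ suc (m ⊔ n)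
[1+m]⊔n≤1+[m⊔n] m zero = s≤s (≤-reflexive (sym (⊔-identityʳ m)))
[1+m]⊔n≤1+[m⊔n] m (suc n) = s≤s (⊔-monoʳ-≤ m (n≤1+n n))

≤-pred2 : ∀ {a b} → suc (suc a) ≤ suc (suc b) → a ≤ b
≤-pred2 (s≤s (s≤s le)) = le

3+≰2 : ∀ {d} → 3 + d ≤ 2 → ⊥
3+≰2 (s≤s (s≤s ()))

≤-eval : ∀ {m n} → {T (m ≤ᵇ n)} → m ≤ n
≤-eval {m} {n} {p} = ≤ᵇ⇒≤ m n p

double[2+n]<2+n+d : ∀ n d → 3 + n ≤ d → double (2 + n) < 2 + n + d
double[2+n]<2+n+d n d le = s≤s (s≤s (subst (_≤ n + d) (trans (+-suc n (suc (suc n))) (cong suc (n+[2+n]≡double[1+n] n))) (+-monoʳ-≤ n le)))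

-- ⟨ e , d , 0 ⟩ stands for a^e b^d, and ⟨ e , d , suc n ⟩ for a^e b^(d ∸ (n + 2)) c_n.
record Val : Set where
  constructor ⟨_,_,_⟩
  field
    aBit : Bool
    bDeg : ℕ
    cTop : ℕ

open Val public

infixl 7 _·_

_·_ : Val → Val → Val
x · y = ⟨ aBit x xor aBit y , bDeg x + bDeg y , cTop x ⊔ cTop y ⟩

𝟙 : Val
𝟙 = ⟨ false , 0 , 0 ⟩

Val-≡ : ∀ {e e' D D' M M'} → e ≡ e' → D ≡ D' → M ≡ M' → ⟨ e , D , M ⟩ ≡ ⟨ e' , D' , M' ⟩
Val-≡ refl refl refl = refl

·-comm : ∀ x y → x · y ≡ y · x
·-comm x y = Val-≡ (xor-comm (aBit x) (aBit y)) (+-comm (bDeg x) (bDeg y)) (⊔-comm (cTop x) (cTop y))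

·-assoc : ∀ x y z → (x · y) · z ≡ x · (y · z)
·-assoc x y z = Val-≡ (xor-assoc (aBit x) (aBit y) (aBit z)) (+-assoc (bDeg x) (bDeg y) (bDeg z)) (⊔-assoc (cTop x) (cTop y) (cTop z))

·-identityʳ : ∀ x → x · 𝟙 ≡ x
·-identityʳ x = Val-≡ (xor-identityʳ (aBit x)) (+-identityʳ (bDeg x)) (⊔-identityʳ (cTop x))

·-swap : ∀ x y z → x · (y · z) ≡ y · (x · z)
·-swap x y z = trans (sym (·-assoc x y z)) (trans (cong (_· z) (·-comm x y)) (·-assoc y x z))

-- 𝒫 on values: PBC is b^m c_n with m ≤ n (then d = m + n + 2 ≤ 2 (n + 1)), PA is a and PBB is b^(2m).
PBC PA PBB PVal : Val → Set
PBC v = aBit v ≡ false × odd (bDeg v) ≡ true × 1 ≤ cTop v × bDeg v ≤ double (cTop v)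
PA v = aBit v ≡ true × bDeg v ≡ 0 × cTop v ≡ 0
PBB v = aBit v ≡ false × odd (bDeg v) ≡ false × 2 ≤ bDeg v × double (cTop v) < bDeg v
PVal v = PBC v ⊎ PA v ⊎ PBB v

PVal? : ∀ v → Dec (PVal v)
PVal? v = (aBit v ≟ᵇ false ×-dec odd (bDeg v) ≟ᵇ true ×-dec 1 ≤? cTop v ×-dec bDeg v ≤? double (cTop v))
  ⊎-dec (aBit v ≟ᵇ true ×-dec bDeg v ≟ 0 ×-dec cTop v ≟ 0)
  ⊎-dec (aBit v ≟ᵇ false ×-dec odd (bDeg v) ≟ᵇ false ×-dec 2 ≤? bDeg v ×-dec double (cTop v) <? bDeg v)

pbc : ∀ {e D M} → e ≡ false → odd D ≡ true → 1 ≤ M → D ≤ double M → PVal ⟨ e , D , M ⟩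
pbc a b c d = inj₁ (a , b , c , d)

pbb : ∀ {e D M} → e ≡ false → odd D ≡ false → 2 ≤ D → double M < D → PVal ⟨ e , D , M ⟩
pbb a b c d = inj₂ (inj₂ (a , b , c , d))

pa : ∀ v → aBit v ≡ true → bDeg v ≡ 0 → cTop v ≡ 0 → PVal v
pa v a b c = inj₂ (inj₁ (a , b , c))

PVal-aFalse : ∀ v → PVal v → aBit v ≡ false → PBC v ⊎ PBB v
PVal-aFalse v (inj₁ s) _ = inj₁ s
PVal-aFalse v (inj₂ (inj₂ s)) _ = inj₂ s
PVal-aFalse v (inj₂ (inj₁ (a≡true , _))) a≡false = ⊥-elim (not-¬ a≡false a≡true)

PVal-aTrue : ∀ v → PVal v → aBit v ≡ true → PA v
PVal-aTrue v (inj₁ (a≡false , _)) a≡true = ⊥-elim (not-¬ a≡true a≡false)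
PVal-aTrue v (inj₂ (inj₂ (a≡false , _))) a≡true = ⊥-elim (not-¬ a≡true a≡false)
PVal-aTrue v (inj₂ (inj₁ s)) _ = s

¬PVal-𝟙 : ¬ PVal 𝟙
¬PVal-𝟙 = toWitnessFalse {a? = PVal? 𝟙} tt

WellFormed : Val → Set
WellFormed v = 1 ≤ cTop v → cTop v < bDeg v

WellFormed-· : ∀ x y → WellFormed x → WellFormed y → WellFormed (x · y)
WellFormed-· x y wx wy h with ≤-total (cTop x) (cTop y)
... | inj₁ le rewrite m≤n⇒m⊔n≡n le = ≤-trans (wy h) (m≤n+m (bDeg y) (bDeg x))
... | inj₂ ge rewrite m≥n⇒m⊔n≡m ge = ≤-trans (wx h) (m≤m+n (bDeg x) (bDeg y))

wellFormed-bDeg≡0 : ∀ v → WellFormed v → bDeg v ≡ 0 → cTop v ≡ 0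
wellFormed-bDeg≡0 ⟨ e , .0 , zero ⟩ wf refl = refl
wellFormed-bDeg≡0 ⟨ e , .0 , suc m ⟩ wf refl with wf (s≤s z≤n)
... | ()

wellFormed-cTop≤ : ∀ {e} my dy {b} → WellFormed ⟨ e , dy , my ⟩ → dy ≤ suc b → my ≤ b
wellFormed-cTop≤ zero dy w le = z≤n
wellFormed-cTop≤ (suc my) dy w le = ≤-pred (≤-trans (w (s≤s z≤n)) le)

genVal : Gen → Val
genVal ga = ⟨ true , 0 , 0 ⟩
genVal gb = ⟨ false , 1 , 0 ⟩
genVal (gc n) = ⟨ false , 2 + n , suc n ⟩

wordVal : Word → Val
wordVal [] = 𝟙
wordVal (g ∷ w) = genVal g · wordVal w

wordVal-++ : ∀ u v → wordVal (u ++ v) ≡ wordVal u · wordVal v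
wordVal-++ [] v = refl
wordVal-++ (g ∷ u) v = trans (cong (genVal g ·_) (wordVal-++ u v)) (sym (·-assoc (genVal g) (wordVal u) (wordVal v)))

wordVal-bpow : ∀ k → wordVal (bpow k) ≡ ⟨ false , k , 0 ⟩
wordVal-bpow zero = refl
wordVal-bpow (suc k) rewrite wordVal-bpow k = refl

wordVal-bpow-gc : ∀ m n → wordVal (bpow m ++ gc n ∷ []) ≡ ⟨ false , m + (2 + n) , suc n ⟩
wordVal-bpow-gc m n = trans (wordVal-++ (bpow m) (gc n ∷ []))
  (trans (cong (_· wordVal (gc n ∷ [])) (wordVal-bpow m)) (Val-≡ refl (cong (m +_) (+-identityʳ (2 + n))) (⊔-identityʳ (suc n))))

-- The c-factor c_(M-1) of a value survives the relation b^(n+1) c_n = b^(2n+3) iff bDeg ≤ 2 M.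
HasC : Val → Set
HasC v = 1 ≤ cTop v × bDeg v ≤ double (cTop v)

hasC? : ∀ v → Dec (HasC v)
hasC? v = (1 ≤? cTop v) ×-dec (bDeg v ≤? double (cTop v))

cTopIf : ∀ v → Dec (HasC v) → ℕ
cTopIf v (yes _) = cTop v
cTopIf v (no _) = 0

canon : Val → Val
canon v = ⟨ aBit v , bDeg v , cTopIf v (hasC? v) ⟩

canon-HasC : ∀ v → HasC v → canon v ≡ v
canon-HasC v h with hasC? v
... | yes _ = refl
... | no ¬h = ⊥-elim (¬h h)

canon-¬HasC : ∀ v → ¬ HasC v → canon v ≡ ⟨ aBit v , bDeg v , 0 ⟩
canon-¬HasC v ¬h with hasC? v
... | yes h = ⊥-elim (¬h h)
... | no _ = refl

cTop-canon≤ : ∀ v → cTop (canon v) ≤ cTop v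
cTop-canon≤ v with hasC? v
... | yes _ = ≤-refl
... | no _ = z≤n

HasC-cTop-mono : ∀ {e d m m'} → m ≤ m' → HasC ⟨ e , d , m ⟩ → HasC ⟨ e , d , m' ⟩
HasC-cTop-mono m≤m' (1≤m , d≤2m) = ≤-trans 1≤m m≤m' , ≤-trans d≤2m (double-mono m≤m')

HasC-·-dominant : ∀ a b → cTop b ≤ cTop a → HasC (a · b) → HasC a
HasC-·-dominant a b b≤a (1≤m , d≤2m) rewrite m≥n⇒m⊔n≡m b≤a = 1≤m , ≤-trans (m≤m+n (bDeg a) (bDeg b)) d≤2m

·-canon-dominant : ∀ a b → cTop b ≤ cTop a → HasC (a · b) → canon a · canon b ≡ a · b
·-canon-dominant a b b≤a h = Val-≡ refl refl (begin
  cTop (canon a) ⊔ cTop (canon b) ≡⟨ cong (λ x → cTop x ⊔ cTop (canon b)) (canon-HasC a (HasC-·-dominant a b b≤a h)) ⟩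
  cTop a ⊔ cTop (canon b)         ≡⟨ m≥n⇒m⊔n≡m (≤-trans (cTop-canon≤ b) b≤a) ⟩
  cTop a                          ≡⟨ m≥n⇒m⊔n≡m b≤a ⟨
  cTop a ⊔ cTop b                 ∎)
  where open ≡-Reasoning

·-canon-HasC : ∀ a b → HasC (a · b) → canon a · canon b ≡ a · b
·-canon-HasC a b h with ≤-total (cTop b) (cTop a)
... | inj₁ b≤a = ·-canon-dominant a b b≤a h
... | inj₂ a≤b = begin
  canon a · canon b ≡⟨ ·-comm (canon a) (canon b) ⟩
  canon b · canon a ≡⟨ ·-canon-dominant b a a≤b (subst HasC (·-comm a b) h) ⟩
  b · a             ≡⟨ ·-comm b a ⟩
  a · b             ∎
  where open ≡-Reasoning

canon-· : ∀ a b → canon (a · b) ≡ canon (canon a · canon b)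
canon-· a b = dec-cases (hasC? (a · b))
  (λ h → cong canon (sym (·-canon-HasC a b h)))
  (λ ¬h → trans (canon-¬HasC (a · b) ¬h)
    (sym (canon-¬HasC (canon a · canon b) (¬h ∘ HasC-cTop-mono {e = aBit a xor aBit b} (⊔-mono-≤ (cTop-canon≤ a) (cTop-canon≤ b))))))

canon-wordVal-resp-≈ : ∀ {u v} → u ≈ v → canon (wordVal u) ≡ canon (wordVal v)
canon-wordVal-resp-≈ ≈-refl = refl
canon-wordVal-resp-≈ (≈-sym p) = sym (canon-wordVal-resp-≈ p)
canon-wordVal-resp-≈ (≈-trans p q) = trans (canon-wordVal-resp-≈ p) (canon-wordVal-resp-≈ q)
canon-wordVal-resp-≈ (≈-cong {u} {u'} {v} {v'} p q) = begin
  canon (wordVal (u ++ v))                      ≡⟨ cong canon (wordVal-++ u v) ⟩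
  canon (wordVal u · wordVal v)                 ≡⟨ canon-· (wordVal u) (wordVal v) ⟩
  canon (canon (wordVal u) · canon (wordVal v)) ≡⟨ cong₂ (λ x y → canon (x · y)) (canon-wordVal-resp-≈ p) (canon-wordVal-resp-≈ q) ⟩
  canon (canon (wordVal u') · canon (wordVal v')) ≡⟨ canon-· (wordVal u') (wordVal v') ⟨
  canon (wordVal u' · wordVal v')               ≡⟨ cong canon (wordVal-++ u' v') ⟨
  canon (wordVal (u' ++ v'))                    ∎
  where open ≡-Reasoning
canon-wordVal-resp-≈ (≈-comm u v) =
  cong canon (trans (wordVal-++ u v) (trans (·-comm (wordVal u) (wordVal v)) (sym (wordVal-++ v u))))
canon-wordVal-resp-≈ rel-a = refl
canon-wordVal-resp-≈ (rel-bc n) = begin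
  canon (wordVal (bpow (n + 1) ++ gc n ∷ []))    ≡⟨ cong canon (wordVal-bpow-gc (n + 1) n) ⟩
  canon ⟨ false , n + 1 + (2 + n) , suc n ⟩     ≡⟨ canon-¬HasC _ (λ (_ , d≤2m) → <⇒≱ d>2m d≤2m) ⟩
  ⟨ false , n + 1 + (2 + n) , 0 ⟩               ≡⟨ cong (λ d → ⟨ false , d , 0 ⟩) (n+1+[2+n]≡2n+3 n) ⟩
  ⟨ false , 2 * n + 3 , 0 ⟩                     ≡⟨ cong canon (wordVal-bpow (2 * n + 3)) ⟨
  canon (wordVal (bpow (2 * n + 3)))             ∎
  where
    open ≡-Reasoning
    n+1+[2+n]≡2n+3 : ∀ n → n + 1 + (2 + n) ≡ 2 * n + 3
    n+1+[2+n]≡2n+3 = solve-∀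
    d>2m : double (suc n) < n + 1 + (2 + n)
    d>2m = subst (_< n + 1 + (2 + n)) (n+[2+n]≡double[1+n] n) (+-monoˡ-< (2 + n) (m<m+n n (s≤s z≤n)))
canon-wordVal-resp-≈ (rel-cc m n m≤n) = cong canon (begin
  wordVal (gc m ∷ gc n ∷ [])            ≡⟨ Val-≡ refl (bDeg≡ m n) (m≤n⇒m⊔n≡n (s≤s m≤n)) ⟩
  ⟨ false , m + 2 + (2 + n) , suc n ⟩   ≡⟨ wordVal-bpow-gc (m + 2) n ⟨
  wordVal (bpow (m + 2) ++ gc n ∷ [])   ∎)
  where
    open ≡-Reasoning
    bDeg≡ : ∀ m n → 2 + m + (2 + n + 0) ≡ m + 2 + (2 + n)
    bDeg≡ = solve-∀

¬HasC⇒double<bDeg : ∀ v → ¬ HasC v → 1 ≤ bDeg v → double (cTop v) < bDeg v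
¬HasC⇒double<bDeg ⟨ e , d , zero ⟩ ¬h 1≤d = 1≤d
¬HasC⇒double<bDeg ⟨ e , d , suc m ⟩ ¬h _ = ≰⇒> (λ d≤2m → ¬h (s≤s z≤n , d≤2m))

¬HasC⇒cTop≡0 : ∀ v → ¬ HasC v → bDeg v ≡ 0 → cTop v ≡ 0
¬HasC⇒cTop≡0 ⟨ e , d , zero ⟩ ¬h _ = refl
¬HasC⇒cTop≡0 ⟨ e , .0 , suc m ⟩ ¬h refl = ⊥-elim (¬h (s≤s z≤n , z≤n))

PVal⇒PVal-canon : ∀ v → PVal v → PVal (canon v)
PVal⇒PVal-canon v p@(inj₁ (_ , _ , 1≤m , d≤2m)) = subst PVal (sym (canon-HasC v (1≤m , d≤2m))) p
PVal⇒PVal-canon v (inj₂ (inj₁ (a , d≡0 , m≡0))) =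
  subst PVal (sym (canon-¬HasC v (λ (1≤m , _) → <⇒≱ 1≤m (≤-reflexive m≡0)))) (pa _ a d≡0 refl)
PVal⇒PVal-canon v (inj₂ (inj₂ (a , ev , 2≤d , 2m<d))) =
  subst PVal (sym (canon-¬HasC v (λ (_ , d≤2m) → <⇒≱ 2m<d d≤2m))) (pbb a ev 2≤d (≤-trans (s≤s z≤n) 2≤d))

PVal-canon⇒PVal : ∀ v → PVal (canon v) → PVal v
PVal-canon⇒PVal v p with hasC? v
... | yes _ = p
... | no ¬h with p
...   | inj₁ (_ , _ , () , _)
...   | inj₂ (inj₁ (a , d≡0 , _)) = pa v a d≡0 (¬HasC⇒cTop≡0 v ¬h d≡0)
...   | inj₂ (inj₂ (a , ev , 2≤d , _)) = pbb a ev 2≤d (¬HasC⇒double<bDeg v ¬h (≤-trans (s≤s z≤n) 2≤d))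

PVal-wordVal-resp-≈ : ∀ {u v} → u ≈ v → PVal (wordVal v) → PVal (wordVal u)
PVal-wordVal-resp-≈ {u} {v} u≈v p =
  PVal-canon⇒PVal (wordVal u) (subst PVal (sym (canon-wordVal-resp-≈ u≈v)) (PVal⇒PVal-canon (wordVal v) p))

≈-setoid : Setoid _ _
≈-setoid = record
  { Carrier = Word
  ; _≈_ = _≈_
  ; isEquivalence = record { refl = ≈-refl ; sym = ≈-sym ; trans = ≈-trans }
  }

bpow-++ : ∀ a b → bpow a ++ bpow b ≡ bpow (a + b)
bpow-++ zero b = refl
bpow-++ (suc a) b = cong (gb ∷_) (bpow-++ a b)

∷-slide : ∀ g u v → g ∷ u ++ v ≈ u ++ g ∷ v
∷-slide g u v = ≈-trans (≈-cong (≈-comm (g ∷ []) u) (≈-refl {v})) (Setoid.reflexive ≈-setoid (++-assoc u (g ∷ []) v))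

data NF : Set where
  nfB : Bool → ℕ → NF
  nfBC : Bool → ℕ → ℕ → NF

aWord : Bool → Word
aWord true = ga ∷ []
aWord false = []

nfWord : NF → Word
nfWord (nfB e d) = aWord e ++ bpow d
nfWord (nfBC e m n) = aWord e ++ bpow m ++ gc n ∷ []

nfVal : NF → Val
nfVal (nfB e d) = ⟨ e , d , 0 ⟩
nfVal (nfBC e m n) = ⟨ e , m + (2 + n) , suc n ⟩

Reduced : NF → Set
Reduced (nfB _ _) = ⊤
Reduced (nfBC e m n) = m ≤ n

HasC-nfBC : ∀ e m n → m ≤ n → HasC ⟨ e , m + (2 + n) , suc n ⟩
HasC-nfBC e m n m≤n = s≤s z≤n , subst (m + (2 + n) ≤_) (n+[2+n]≡double[1+n] n) (+-monoˡ-≤ (2 + n) m≤n)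

canon-nfVal : ∀ c → Reduced c → canon (nfVal c) ≡ nfVal c
canon-nfVal (nfB e d) _ = canon-¬HasC _ (λ (1≤0 , _) → <⇒≱ 1≤0 z≤n)
canon-nfVal (nfBC e m n) m≤n = canon-HasC _ (HasC-nfBC e m n m≤n)

absorb : Bool → ℕ → ℕ → NF
absorb e j n with j ≤? n
... | yes _ = nfBC e j n
... | no _ = nfB e (j + (2 + n))

absorb-reduced : ∀ e j n → Reduced (absorb e j n)
absorb-reduced e j n with j ≤? n
... | yes j≤n = j≤n
... | no _ = tt

canon-absorb : ∀ e j n → canon ⟨ e , j + (2 + n) , suc n ⟩ ≡ nfVal (absorb e j n)
canon-absorb e j n with j ≤? n
... | yes j≤n = canon-HasC _ (HasC-nfBC e j n j≤n)
... | no j≰n = canon-¬HasC _ λ (_ , le) →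
  j≰n (+-cancelʳ-≤ (2 + n) j n (subst (j + (2 + n) ≤_) (sym (n+[2+n]≡double[1+n] n)) le))

bpow-gc-absorbed : ∀ j n → n < j → bpow j ++ gc n ∷ [] ≈ bpow (j + (2 + n))
bpow-gc-absorbed j n n<j = begin
  bpow j ++ gc n ∷ []                       ≡⟨ cong (λ i → bpow i ++ gc n ∷ []) j≡t+[n+1] ⟩
  bpow (t + (n + 1)) ++ gc n ∷ []           ≡⟨ cong (_++ gc n ∷ []) (bpow-++ t (n + 1)) ⟨
  (bpow t ++ bpow (n + 1)) ++ gc n ∷ []     ≡⟨ ++-assoc (bpow t) (bpow (n + 1)) (gc n ∷ []) ⟩
  bpow t ++ bpow (n + 1) ++ gc n ∷ []       ≈⟨ ≈-cong (≈-refl {bpow t}) (rel-bc n) ⟩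
  bpow t ++ bpow (2 * n + 3)                ≡⟨ bpow-++ t (2 * n + 3) ⟩
  bpow (t + (2 * n + 3))                    ≡⟨ cong bpow (trans (exponent t n) (cong (_+ (2 + n)) (sym j≡t+[n+1]))) ⟩
  bpow (j + (2 + n))                        ∎
  where
    open SetoidReasoning ≈-setoid
    t = j ∸ suc n
    j≡t+[n+1] : j ≡ t + (n + 1)
    j≡t+[n+1] = trans (sym (m∸n+n≡m n<j)) (cong (t +_) (+-comm 1 n))
    exponent : ∀ t n → t + (2 * n + 3) ≡ t + (n + 1) + (2 + n)
    exponent = solve-∀

absorb-word : ∀ e j n → aWord e ++ bpow j ++ gc n ∷ [] ≈ nfWord (absorb e j n)
absorb-word e j n with j ≤? n
... | yes _ = ≈-refl
... | no j≰n = ≈-cong (≈-refl {aWord e}) (bpow-gc-absorbed j n (≰⇒> j≰n))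

gc-gc-word : ∀ e m k n → k ≤ n → aWord e ++ bpow m ++ gc k ∷ gc n ∷ [] ≈ aWord e ++ bpow (m + (2 + k)) ++ gc n ∷ []
gc-gc-word e m k n k≤n = ≈-cong (≈-refl {aWord e}) (begin
  bpow m ++ gc k ∷ gc n ∷ []               ≈⟨ ≈-cong (≈-refl {bpow m}) (rel-cc k n k≤n) ⟩
  bpow m ++ bpow (k + 2) ++ gc n ∷ []      ≡⟨ ++-assoc (bpow m) (bpow (k + 2)) (gc n ∷ []) ⟨
  (bpow m ++ bpow (k + 2)) ++ gc n ∷ []    ≡⟨ cong (λ w → w ++ gc n ∷ []) (trans (bpow-++ m (k + 2)) (cong (λ i → bpow (m + i)) (+-comm k 2))) ⟩
  bpow (m + (2 + k)) ++ gc n ∷ []          ∎)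
  where open SetoidReasoning ≈-setoid

gc-into-nfWord : ∀ k e m n → gc k ∷ aWord e ++ bpow m ++ gc n ∷ [] ≈ aWord e ++ bpow m ++ gc k ∷ gc n ∷ []
gc-into-nfWord k e m n = begin
  gc k ∷ aWord e ++ bpow m ++ gc n ∷ []     ≡⟨ cong (gc k ∷_) (++-assoc (aWord e) (bpow m) (gc n ∷ [])) ⟨
  gc k ∷ (aWord e ++ bpow m) ++ gc n ∷ []   ≈⟨ ∷-slide (gc k) (aWord e ++ bpow m) (gc n ∷ []) ⟩
  (aWord e ++ bpow m) ++ gc k ∷ gc n ∷ []   ≡⟨ ++-assoc (aWord e) (bpow m) (gc k ∷ gc n ∷ []) ⟩
  aWord e ++ bpow m ++ gc k ∷ gc n ∷ []     ∎
  where open SetoidReasoning ≈-setoid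

nfMul : Gen → NF → NF
nfMul ga (nfB e d) = nfB (not e) d
nfMul ga (nfBC e m n) = nfBC (not e) m n
nfMul gb (nfB e d) = nfB e (suc d)
nfMul gb (nfBC e m n) = absorb e (suc m) n
nfMul (gc k) (nfB e d) = absorb e d k
nfMul (gc k) (nfBC e m n) with k ≤? n
... | yes _ = absorb e (m + (2 + k)) n
... | no _ = absorb e (m + (2 + n)) k

nfMul-reduced : ∀ g c → Reduced c → Reduced (nfMul g c)
nfMul-reduced ga (nfB e d) _ = tt
nfMul-reduced ga (nfBC e m n) m≤n = m≤n
nfMul-reduced gb (nfB e d) _ = tt
nfMul-reduced gb (nfBC e m n) _ = absorb-reduced e (suc m) n
nfMul-reduced (gc k) (nfB e d) _ = absorb-reduced e d k
nfMul-reduced (gc k) (nfBC e m n) _ with k ≤? n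
... | yes _ = absorb-reduced e (m + (2 + k)) n
... | no _ = absorb-reduced e (m + (2 + n)) k

canon-nfMul : ∀ g c → Reduced c → canon (genVal g · nfVal c) ≡ nfVal (nfMul g c)
canon-nfMul ga (nfB e d) _ = canon-nfVal (nfB (not e) d) tt
canon-nfMul ga (nfBC e m n) m≤n = canon-nfVal (nfBC (not e) m n) m≤n
canon-nfMul gb (nfB e d) _ = canon-nfVal (nfB e (suc d)) tt
canon-nfMul gb (nfBC e m n) _ = canon-absorb e (suc m) n
canon-nfMul (gc k) (nfB e d) _ =
  trans (cong canon (Val-≡ refl (+-comm (2 + k) d) (⊔-identityʳ (suc k)))) (canon-absorb e d k)
canon-nfMul (gc k) (nfBC e m n) _ with k ≤? n
... | yes k≤n = trans (cong canon (Val-≡ refl (bDeg≡ k m n) (m≤n⇒m⊔n≡n (s≤s k≤n)))) (canon-absorb e (m + (2 + k)) n)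
  where
    bDeg≡ : ∀ k m n → 2 + k + (m + (2 + n)) ≡ m + (2 + k) + (2 + n)
    bDeg≡ = solve-∀
... | no k≰n = trans (cong canon (Val-≡ refl (+-comm (2 + k) (m + (2 + n))) (m≥n⇒m⊔n≡m (<⇒≤ (s≤s (≰⇒> k≰n))))))
  (canon-absorb e (m + (2 + n)) k)

nfMul-word : ∀ g c → Reduced c → g ∷ nfWord c ≈ nfWord (nfMul g c)
nfMul-word ga (nfB false d) _ = ≈-refl
nfMul-word ga (nfB true d) _ = ≈-cong rel-a (≈-refl {bpow d})
nfMul-word ga (nfBC false m n) _ = ≈-refl
nfMul-word ga (nfBC true m n) _ = ≈-cong rel-a (≈-refl {bpow m ++ gc n ∷ []})
nfMul-word gb (nfB e d) _ = ∷-slide gb (aWord e) (bpow d)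
nfMul-word gb (nfBC e m n) _ = ≈-trans (∷-slide gb (aWord e) (bpow m ++ gc n ∷ [])) (absorb-word e (suc m) n)
nfMul-word (gc k) (nfB e d) _ = ≈-trans slide (absorb-word e d k)
  where
    open SetoidReasoning ≈-setoid
    slide : gc k ∷ aWord e ++ bpow d ≈ aWord e ++ bpow d ++ gc k ∷ []
    slide = begin
      gc k ∷ aWord e ++ bpow d             ≡⟨ cong (gc k ∷_) (++-identityʳ (aWord e ++ bpow d)) ⟨
      gc k ∷ (aWord e ++ bpow d) ++ []     ≈⟨ ∷-slide (gc k) (aWord e ++ bpow d) [] ⟩
      (aWord e ++ bpow d) ++ gc k ∷ []     ≡⟨ ++-assoc (aWord e) (bpow d) (gc k ∷ []) ⟩
      aWord e ++ bpow d ++ gc k ∷ []       ∎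
nfMul-word (gc k) (nfBC e m n) _ with k ≤? n
... | yes k≤n = ≈-trans (gc-into-nfWord k e m n)
  (≈-trans (gc-gc-word e m k n k≤n) (absorb-word e (m + (2 + k)) n))
... | no k≰n = ≈-trans (gc-into-nfWord k e m n)
  (≈-trans (≈-cong (≈-refl {aWord e}) (≈-cong (≈-refl {bpow m}) (≈-comm (gc k ∷ []) (gc n ∷ []))))
  (≈-trans (gc-gc-word e m n k (<⇒≤ (≰⇒> k≰n))) (absorb-word e (m + (2 + n)) k)))

normalForm : ∀ w → Σ NF λ c → Reduced c × w ≈ nfWord c × canon (wordVal w) ≡ nfVal c
normalForm [] = nfB false 0 , tt , ≈-refl , refl
normalForm (g ∷ w) with normalForm w
... | c , red , w≈c , canon≡ = nfMul g c , nfMul-reduced g c red , ≈-trans (≈-cong (≈-refl {g ∷ []}) w≈c) (nfMul-word g c red) , value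
  where
    open ≡-Reasoning
    value : canon (genVal g · wordVal w) ≡ nfVal (nfMul g c)
    value = begin
      canon (genVal g · wordVal w)               ≡⟨ canon-· (genVal g) (wordVal w) ⟩
      canon (canon (genVal g) · canon (wordVal w)) ≡⟨ cong (λ x → canon (canon (genVal g) · x)) (trans canon≡ (sym (canon-nfVal c red))) ⟩
      canon (canon (genVal g) · canon (nfVal c)) ≡⟨ canon-· (genVal g) (nfVal c) ⟨
      canon (genVal g · nfVal c)                 ≡⟨ canon-nfMul g c red ⟩
      nfVal (nfMul g c)                          ∎

odd-m+[2+n] : ∀ m n → odd (m + (2 + n)) ≡ odd (m + n)
odd-m+[2+n] m n = cong odd (trans (+-suc m (suc n)) (cong suc (+-suc m n)))

InPSet⇒PVal : ∀ w → InPSet w → PVal (wordVal w)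
InPSet⇒PVal w (inj₁ w≈a) = PVal-wordVal-resp-≈ w≈a (toWitness {a? = PVal? _} tt)
InPSet⇒PVal w (inj₂ (inj₁ (m , 1≤m , w≈b²ᵐ))) = PVal-wordVal-resp-≈ w≈b²ᵐ (subst PVal (sym (wordVal-bpow (2 * m)))
  (subst (λ d → PVal ⟨ false , d , 0 ⟩) (double≡2* m) (pbb refl (odd-double m) (double-mono 1≤m) (≤-trans (s≤s z≤n) (double-mono 1≤m)))))
InPSet⇒PVal w (inj₂ (inj₂ (m , n , m≤n , odd[m+n] , w≈bᵐcₙ))) = PVal-wordVal-resp-≈ w≈bᵐcₙ (subst PVal (sym (wordVal-bpow-gc m n))
  (pbc refl (trans (odd-m+[2+n] m n) (%2≡1⇒odd (m + n) odd[m+n])) (s≤s z≤n) (proj₂ (HasC-nfBC false m n m≤n))))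

PVal-nfVal⇒InPSet : ∀ {w} c → Reduced c → w ≈ nfWord c → PVal (nfVal c) → InPSet w
PVal-nfVal⇒InPSet (nfB e d) _ _ (inj₁ (_ , _ , () , _))
PVal-nfVal⇒InPSet (nfB .true .0) _ w≈a (inj₂ (inj₁ (refl , refl , _))) = inj₁ w≈a
PVal-nfVal⇒InPSet {w} (nfB .false d) _ w≈bᵈ (inj₂ (inj₂ (refl , ev , 2≤d , _))) with even⇒double d ev
... | zero , refl = ⊥-elim (<⇒≱ (s≤s z≤n) 2≤d)
... | suc h , refl = inj₂ (inj₁ (suc h , s≤s z≤n , subst (λ i → w ≈ bpow i) (double≡2* (suc h)) w≈bᵈ))
PVal-nfVal⇒InPSet (nfBC .false m n) m≤n w≈bᵐcₙ (inj₁ (refl , od , _ , _)) =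
  inj₂ (inj₂ (m , n , m≤n , odd⇒%2≡1 (m + n) (trans (sym (odd-m+[2+n] m n)) od) , w≈bᵐcₙ))
PVal-nfVal⇒InPSet (nfBC e m n) _ _ (inj₂ (inj₁ (_ , d≡0 , _))) with trans (sym (+-suc m (suc n))) d≡0
... | ()
PVal-nfVal⇒InPSet (nfBC e m n) m≤n _ (inj₂ (inj₂ (_ , _ , _ , 2m<d))) = ⊥-elim (<⇒≱ 2m<d (proj₂ (HasC-nfBC e m n m≤n)))

InPSet⇔PVal : ∀ w → InPSet w ⇔ PVal (wordVal w)
InPSet⇔PVal w = mk⇔ (InPSet⇒PVal w) from
  where
    from : PVal (wordVal w) → InPSet w
    from p with normalForm w
    ... | c , red , w≈c , canon≡ = PVal-nfVal⇒InPSet c red w≈c (subst PVal canon≡ (PVal⇒PVal-canon (wordVal w) p))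

bump : Val → Val
bump v = ⟨ aBit v , suc (bDeg v) , suc (cTop v) ⟩

-- heapVal k is the value of Φ H_k; the entry for k = 0 matches the junk value Φheap 0 = a b c_0.
heapVal : ℕ → Val
heapVal 0 = ⟨ true , 3 , 1 ⟩
heapVal 1 = ⟨ false , 0 , 0 ⟩
heapVal 2 = ⟨ true , 0 , 0 ⟩
heapVal 3 = ⟨ false , 1 , 0 ⟩
heapVal 4 = ⟨ true , 1 , 0 ⟩
heapVal 5 = ⟨ false , 0 , 0 ⟩
heapVal 6 = ⟨ true , 0 , 0 ⟩
heapVal 7 = ⟨ false , 1 , 0 ⟩
heapVal 8 = ⟨ true , 1 , 0 ⟩
heapVal 9 = ⟨ false , 2 , 1 ⟩
heapVal 10 = ⟨ true , 2 , 1 ⟩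
heapVal 11 = ⟨ false , 3 , 2 ⟩
heapVal 12 = ⟨ true , 3 , 1 ⟩
heapVal (suc (suc (suc (suc (suc (suc (suc (suc (suc (suc (suc (suc (suc k))))))))))))) =
  bump (heapVal (suc (suc (suc (suc (suc (suc (suc (suc (suc (suc (suc k))))))))))))

heapVal-odd : ∀ n → heapVal (9 + double n) ≡ ⟨ false , suc (suc n) , suc n ⟩
heapVal-odd zero = refl
heapVal-odd (suc zero) = refl
heapVal-odd (suc (suc n)) = cong bump (heapVal-odd (suc n))

heapVal-even : ∀ n → heapVal (12 + double n) ≡ ⟨ true , 3 + n , suc n ⟩
heapVal-even zero = refl
heapVal-even (suc n) = cong bump (heapVal-even n)

aBit-heapVal : ∀ k → aBit (heapVal k) ≡ not (odd k)
aBit-heapVal 0 = refl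
aBit-heapVal 1 = refl
aBit-heapVal 2 = refl
aBit-heapVal 3 = refl
aBit-heapVal 4 = refl
aBit-heapVal 5 = refl
aBit-heapVal 6 = refl
aBit-heapVal 7 = refl
aBit-heapVal 8 = refl
aBit-heapVal 9 = refl
aBit-heapVal 10 = refl
aBit-heapVal 11 = refl
aBit-heapVal 12 = refl
aBit-heapVal (suc (suc (suc (suc (suc (suc (suc (suc (suc (suc (suc (suc (suc k))))))))))))) =
  aBit-heapVal (suc (suc (suc (suc (suc (suc (suc (suc (suc (suc (suc k)))))))))))

heapVal-cTop<bDeg : ∀ j → cTop (heapVal (9 + j)) < bDeg (heapVal (9 + j))
heapVal-cTop<bDeg 0 = ≤-eval
heapVal-cTop<bDeg 1 = ≤-eval
heapVal-cTop<bDeg 2 = ≤-eval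
heapVal-cTop<bDeg 3 = ≤-eval
heapVal-cTop<bDeg (suc (suc (suc (suc j)))) = s≤s (heapVal-cTop<bDeg (suc (suc j)))

heapVal-wellFormed : ∀ k → WellFormed (heapVal k)
heapVal-wellFormed 0 _ = ≤-eval
heapVal-wellFormed 1 ()
heapVal-wellFormed 2 ()
heapVal-wellFormed 3 ()
heapVal-wellFormed 4 ()
heapVal-wellFormed 5 ()
heapVal-wellFormed 6 ()
heapVal-wellFormed 7 ()
heapVal-wellFormed 8 ()
heapVal-wellFormed (suc (suc (suc (suc (suc (suc (suc (suc (suc j))))))))) _ = heapVal-cTop<bDeg j

take1-bDeg≤ : ∀ r → bDeg (heapVal (2 + r)) ≤ suc (bDeg (heapVal (1 + r)))
take1-bDeg≤ 0 = ≤-eval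
take1-bDeg≤ 1 = ≤-eval
take1-bDeg≤ 2 = ≤-eval
take1-bDeg≤ 3 = ≤-eval
take1-bDeg≤ 4 = ≤-eval
take1-bDeg≤ 5 = ≤-eval
take1-bDeg≤ 6 = ≤-eval
take1-bDeg≤ 7 = ≤-eval
take1-bDeg≤ 8 = ≤-eval
take1-bDeg≤ 9 = ≤-eval
take1-bDeg≤ 10 = ≤-eval
take1-bDeg≤ 11 = ≤-eval
take1-bDeg≤ (suc (suc (suc (suc (suc (suc (suc (suc (suc (suc (suc (suc j)))))))))))) =
  s≤s (take1-bDeg≤ (suc (suc (suc (suc (suc (suc (suc (suc (suc (suc j)))))))))))

Take2Step : Val → Val → Set
Take2Step h o = (bDeg h ≡ suc (bDeg o) × cTop o ≤ cTop h × cTop h ≤ suc (cTop o)) ⊎ (bDeg o ≡ suc (bDeg h) × cTop o ≡ cTop h)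

Take2Step-bump : ∀ h o → Take2Step h o → Take2Step (bump h) (bump o)
Take2Step-bump h o (inj₁ (a , b , c)) = inj₁ (cong suc a , s≤s b , s≤s c)
Take2Step-bump h o (inj₂ (a , b)) = inj₂ (cong suc a , cong suc b)

take2-step : ∀ r → Take2Step (heapVal (3 + r)) (heapVal (1 + r))
take2-step 0 = inj₁ (refl , ≤-eval , ≤-eval)
take2-step 1 = inj₁ (refl , ≤-eval , ≤-eval)
take2-step 2 = inj₂ (refl , refl)
take2-step 3 = inj₂ (refl , refl)
take2-step 4 = inj₁ (refl , ≤-eval , ≤-eval)
take2-step 5 = inj₁ (refl , ≤-eval , ≤-eval)
take2-step 6 = inj₁ (refl , ≤-eval , ≤-eval)
take2-step 7 = inj₁ (refl , ≤-eval , ≤-eval)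
take2-step 8 = inj₁ (refl , ≤-eval , ≤-eval)
take2-step 9 = inj₁ (refl , ≤-eval , ≤-eval)
take2-step 10 = inj₁ (refl , ≤-eval , ≤-eval)
take2-step 11 = inj₁ (refl , ≤-eval , ≤-eval)
take2-step (suc (suc (suc (suc (suc (suc (suc (suc (suc (suc (suc (suc j)))))))))))) =
  Take2Step-bump (heapVal (13 + j)) (heapVal (11 + j)) (take2-step (suc (suc (suc (suc (suc (suc (suc (suc (suc (suc j)))))))))))

take1-aHeap : ∀ r → aBit (heapVal (2 + r)) ≡ true →
  aBit (heapVal (1 + r)) ≡ false × bDeg (heapVal (1 + r)) ≡ bDeg (heapVal (2 + r)) ×
  cTop (heapVal (1 + r)) ≤ suc (cTop (heapVal (2 + r))) × (cTop (heapVal (2 + r)) ≡ 0 → cTop (heapVal (1 + r)) ≡ 0)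
take1-aHeap 0 _ = refl , refl , ≤-eval , (λ _ → refl)
take1-aHeap 1 ()
take1-aHeap 2 _ = refl , refl , ≤-eval , (λ _ → refl)
take1-aHeap 3 ()
take1-aHeap 4 _ = refl , refl , ≤-eval , (λ _ → refl)
take1-aHeap 5 ()
take1-aHeap 6 _ = refl , refl , ≤-eval , (λ _ → refl)
take1-aHeap 7 ()
take1-aHeap 8 _ = refl , refl , ≤-eval , (λ ())
take1-aHeap 9 ()
take1-aHeap 10 _ = refl , refl , ≤-eval , (λ ())
take1-aHeap 11 ()
take1-aHeap (suc (suc (suc (suc (suc (suc (suc (suc (suc (suc (suc (suc j)))))))))))) e with take1-aHeap (suc (suc (suc (suc (suc (suc (suc (suc (suc (suc j)))))))))) e
... | a , b , c , _ = a , cong suc b , s≤s c , (λ ())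

take2-bDeg-grows⇒0 : ∀ r → bDeg (heapVal (1 + r)) ≡ suc (bDeg (heapVal (3 + r))) → bDeg (heapVal (3 + r)) ≡ 0
take2-bDeg-grows⇒0 0 ()
take2-bDeg-grows⇒0 1 ()
take2-bDeg-grows⇒0 2 _ = refl
take2-bDeg-grows⇒0 3 _ = refl
take2-bDeg-grows⇒0 4 ()
take2-bDeg-grows⇒0 5 ()
take2-bDeg-grows⇒0 6 ()
take2-bDeg-grows⇒0 7 ()
take2-bDeg-grows⇒0 8 ()
take2-bDeg-grows⇒0 9 ()
take2-bDeg-grows⇒0 10 ()
take2-bDeg-grows⇒0 11 ()
take2-bDeg-grows⇒0 (suc (suc (suc (suc (suc (suc (suc (suc (suc (suc (suc (suc j)))))))))))) eq
  with take2-bDeg-grows⇒0 (suc (suc (suc (suc (suc (suc (suc (suc (suc (suc j)))))))))) (suc-injective eq)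
... | ()

take2-bHeap : ∀ r → 1 ≤ bDeg (heapVal (3 + r)) →
  aBit (heapVal (1 + r)) ≡ aBit (heapVal (3 + r)) × bDeg (heapVal (3 + r)) ≡ suc (bDeg (heapVal (1 + r))) ×
  cTop (heapVal (1 + r)) ≤ cTop (heapVal (3 + r))
take2-bHeap r d with take2-step r
... | inj₁ (dd , mo , _) = trans (aBit-heapVal (suc r)) (sym (aBit-heapVal (suc (suc (suc r))))) , dd , mo
... | inj₂ (dd , _) with subst (1 ≤_) (take2-bDeg-grows⇒0 r dd) d
...   | ()

bDeg-heapVal-7+≢0 : ∀ j → bDeg (heapVal (7 + j)) ≢ 0
bDeg-heapVal-7+≢0 0 ()
bDeg-heapVal-7+≢0 1 ()
bDeg-heapVal-7+≢0 2 ()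
bDeg-heapVal-7+≢0 3 ()
bDeg-heapVal-7+≢0 4 ()
bDeg-heapVal-7+≢0 5 ()
bDeg-heapVal-7+≢0 (suc (suc (suc (suc (suc (suc j)))))) ()

CHeap : ℕ → Set
CHeap k = (∃[ n ] k ≡ 9 + double n) ⊎ (k ≡ 10) ⊎ (∃[ n ] k ≡ 12 + double n)

9+-cases : ∀ j → CHeap (9 + j)
9+-cases 0 = inj₁ (0 , refl)
9+-cases 1 = inj₂ (inj₁ refl)
9+-cases 2 = inj₁ (1 , refl)
9+-cases 3 = inj₂ (inj₂ (0 , refl))
9+-cases (suc (suc (suc (suc j)))) with 9+-cases (suc (suc j))
... | inj₁ (n , eq) = inj₁ (suc n , cong (2 +_) eq)
... | inj₂ (inj₁ ())
... | inj₂ (inj₂ (n , eq)) = inj₂ (inj₂ (suc n , cong (2 +_) eq))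

cHeap-cases : ∀ k → 1 ≤ k → 1 ≤ cTop (heapVal k) → CHeap k
cHeap-cases 0 () _
cHeap-cases 1 _ ()
cHeap-cases 2 _ ()
cHeap-cases 3 _ ()
cHeap-cases 4 _ ()
cHeap-cases 5 _ ()
cHeap-cases 6 _ ()
cHeap-cases 7 _ ()
cHeap-cases 8 _ ()
cHeap-cases (suc (suc (suc (suc (suc (suc (suc (suc (suc j))))))))) _ _ = 9+-cases j

Φheap-odd : ∀ n → Φheap (11 + double n) ≡ gc (suc n) ∷ []
Φheap-odd n rewrite suc-double%2≡1 (5 + n) | double/2≡n (suc n) = refl

Φheap-even : ∀ n → Φheap (12 + double n) ≡ ga ∷ gb ∷ gc n ∷ []
Φheap-even n rewrite double%2≡0 (6 + n) | double/2≡n n = refl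

wordVal-Φheap : ∀ k → wordVal (Φheap k) ≡ heapVal k
wordVal-Φheap 0 = refl
wordVal-Φheap 1 = refl
wordVal-Φheap 2 = refl
wordVal-Φheap 3 = refl
wordVal-Φheap 4 = refl
wordVal-Φheap 5 = refl
wordVal-Φheap 6 = refl
wordVal-Φheap 7 = refl
wordVal-Φheap 8 = refl
wordVal-Φheap 9 = refl
wordVal-Φheap 10 = refl
wordVal-Φheap (suc (suc (suc (suc (suc (suc (suc (suc (suc (suc (suc j))))))))))) with double⊎suc-double j
... | inj₁ (n , refl) = trans (cong wordVal (Φheap-odd n)) (trans (·-identityʳ _) (sym (heapVal-odd (suc n))))
... | inj₂ (n , refl) = trans (cong wordVal (Φheap-even n))
  (trans (Val-≡ refl (cong (3 +_) (+-identityʳ n)) (⊔-identityʳ (suc n))) (sym (heapVal-even n)))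

val : List ℕ → Val
val [] = 𝟙
val (k ∷ G) = heapVal k · val G

val-++ : ∀ G H → val (G ++ H) ≡ val G · val H
val-++ [] H = refl
val-++ (k ∷ G) H = trans (cong (heapVal k ·_) (val-++ G H)) (sym (·-assoc (heapVal k) (val G) (val H)))

val-wellFormed : ∀ G → WellFormed (val G)
val-wellFormed [] ()
val-wellFormed (k ∷ G) = WellFormed-· (heapVal k) (val G) (heapVal-wellFormed k) (val-wellFormed G)

wordVal-Φ : ∀ G → wordVal (Φ G) ≡ val G
wordVal-Φ [] = refl
wordVal-Φ (k ∷ G) = trans (wordVal-++ (Φheap k) (Φ G)) (cong₂ _·_ (wordVal-Φheap k) (wordVal-Φ G))

data Pick : List ℕ → ℕ → List ℕ → Set where
  here : ∀ {k G} → Pick (k ∷ G) k G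
  there : ∀ {j k G R} → Pick G k R → Pick (j ∷ G) k (j ∷ R)

pick-val : ∀ {G k R} → Pick G k R → val G ≡ heapVal k · val R
pick-val here = refl
pick-val (there {j} {k} {G} {R} p) = trans (cong (heapVal j ·_) (pick-val p)) (·-swap (heapVal j) (heapVal k) (val R))

pick-move : ∀ {G k R hs} → Pick G k R → HeapMove k hs → Σ (List ℕ) λ G' → Move G G' × val G' ≡ val hs · val R
pick-move {G = k ∷ G} {hs = hs} here m = hs ++ G , here m , val-++ hs G
pick-move {hs = hs} (there {j} {k} {G} {R} p) m with pick-move p m
... | G' , mv , eq = j ∷ G' , there mv , trans (cong (heapVal j ·_) eq) (·-swap (heapVal j) (val hs) (val R))

move-pick : ∀ {G G'} → Move G G' → Σ ℕ λ k → Σ (List ℕ) λ hs → Σ (List ℕ) λ R → Pick G k R × HeapMove k hs × val G' ≡ val hs · val R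
move-pick (here {k} {hs} {G} m) = k , hs , G , here , m , val-++ hs G
move-pick (there {j} mv) with move-pick mv
... | k , hs , R , p , m , eq = k , hs , j ∷ R , there p , m , trans (cong (heapVal j ·_) eq) (·-swap (heapVal j) (val hs) (val R))

pick-pick : ∀ {G h R k R'} → Pick G h R → Pick R k R' → Σ (List ℕ) λ R'' → Pick G k R'' × val R'' ≡ heapVal h · val R'
pick-pick here q = _ , there q , refl
pick-pick (there p) here = _ , here , pick-val p
pick-pick {h = h} (there {j} p) (there {R = R'} q) with pick-pick p q
... | R'' , p'' , eq = j ∷ R'' , there p'' , trans (cong (heapVal j ·_) eq) (·-swap (heapVal j) (heapVal h) (val R'))

PickSuch : List ℕ → (ℕ → Set) → Set
PickSuch G P = Σ ℕ λ k → Σ (List ℕ) λ R → Pick G k R × P k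

find-aHeap : ∀ G → aBit (val G) ≡ true → PickSuch G (λ k → aBit (heapVal k) ≡ true)
find-aHeap [] ()
find-aHeap (k ∷ G) e with aBit (heapVal k) in ek
... | true = k , G , here , ek
... | false with find-aHeap G e
...   | k' , R , p , ek' = k' , k ∷ R , there p , ek'

find-bHeap : ∀ G → 1 ≤ bDeg (val G) → PickSuch G (λ k → 1 ≤ bDeg (heapVal k))
find-bHeap [] ()
find-bHeap (k ∷ G) d with 1 ≤? bDeg (heapVal k)
... | yes le = k , G , here , le
... | no nle with find-bHeap G (subst (λ z → 1 ≤ z + bDeg (val G)) (n≤0⇒n≡0 (≤-pred (≰⇒> nle))) d)
...   | k' , R , p , q = k' , k ∷ R , there p , q

find-topHeap : ∀ G → 1 ≤ cTop (val G) → PickSuch G (λ k → cTop (heapVal k) ≡ cTop (val G))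
find-topHeap [] ()
find-topHeap (k ∷ G) d with cTop (val G) ≤? cTop (heapVal k)
... | yes le = k , G , here , sym (m≥n⇒m⊔n≡m le)
... | no nle with find-topHeap G (≤-trans (s≤s z≤n) (≰⇒> nle))
...   | k' , R , p , q = k' , k ∷ R , there p , trans q (sym (m≤n⇒m⊔n≡n (<⇒≤ (≰⇒> nle))))

pick-cTop≤ : ∀ {G k R} → Pick G k R → cTop (heapVal k) ≤ cTop (val G) × cTop (val R) ≤ cTop (val G)
pick-cTop≤ {k = k} {R} p rewrite pick-val p = m≤m⊔n (cTop (heapVal k)) (cTop (val R)) , m≤n⊔m (cTop (heapVal k)) (cTop (val R))

pick-All : ∀ {P : ℕ → Set} {G k R} → Pick G k R → All P G → P k × All P R
pick-All here (px ∷ a) = px , a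
pick-All (there p) (px ∷ a) with pick-All p a
... | pk , ar = pk , px ∷ ar

-- No move joins two 𝒫-values

flip-PVal⇒PA : ∀ h o y → aBit o ≡ not (aBit h) → aBit (h · y) ≡ false → PVal (o · y) →
  bDeg o ≡ 0 × bDeg y ≡ 0 × cTop y ≡ 0
flip-PVal⇒PA h o y o-flips hy≡false p = extract (PVal-aTrue (o · y) p oy≡true)
  where
    oy≡true : aBit (o · y) ≡ true
    oy≡true = trans (cong (_xor aBit y) o-flips) (trans (sym (not-distribˡ-xor (aBit h) (aBit y))) (cong not hy≡false))
    extract : PA (o · y) → bDeg o ≡ 0 × bDeg y ≡ 0 × cTop y ≡ 0
    extract (_ , d≡0 , m≡0) = m+n≡0⇒m≡0 (bDeg o) d≡0 , m+n≡0⇒n≡0 (bDeg o) d≡0 , m⊔n≡0⇒n≡0 (cTop o) (cTop y) m≡0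

-- A change of bDeg by one flips its parity, which separates PBC from PBC and PBB from PBB;
-- the bounds on cTop separate PBC from PBB.
PVal-Take2Step-disjoint : ∀ E D D' M M' → Take2Step ⟨ E , D , M ⟩ ⟨ E , D' , M' ⟩ →
  PVal ⟨ E , D , M ⟩ → PVal ⟨ E , D' , M' ⟩ → ⊥
PVal-Take2Step-disjoint E _ D' M M' (inj₁ (refl , m1 , m2)) (inj₁ (refl , od , _ , le)) (inj₁ (_ , od' , _)) = odd≢odd-suc D' (trans od' (sym od))
PVal-Take2Step-disjoint E _ D' M M' (inj₁ (refl , m1 , m2)) (inj₁ (refl , od , _ , le)) (inj₂ (inj₁ (() , _)))
PVal-Take2Step-disjoint E _ D' M M' (inj₁ (refl , m1 , m2)) (inj₁ (refl , od , _ , le)) (inj₂ (inj₂ (_ , _ , _ , lt'))) =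
  <⇒≱ lt' (≤-pred (≤-pred (≤-trans (odd≤double⇒< (suc D') M od le) (double-mono m2))))
PVal-Take2Step-disjoint E _ D' M M' (inj₁ (refl , m1 , m2)) (inj₂ (inj₁ (_ , () , _))) p'
PVal-Take2Step-disjoint E _ D' M M' (inj₁ (refl , m1 , m2)) (inj₂ (inj₂ (refl , ev , _ , lt))) (inj₁ (_ , od' , _ , le')) =
  <⇒≱ (≤-trans (s≤s (double-mono m1)) (≤-pred (even>double⇒2+≤ (suc D') M ev lt))) le'
PVal-Take2Step-disjoint E _ D' M M' (inj₁ (refl , m1 , m2)) (inj₂ (inj₂ (refl , ev , _ , lt))) (inj₂ (inj₁ (() , _)))
PVal-Take2Step-disjoint E _ D' M M' (inj₁ (refl , m1 , m2)) (inj₂ (inj₂ (refl , ev , _ , lt))) (inj₂ (inj₂ (_ , ev' , _))) = odd≢odd-suc D' (trans ev' (sym ev))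
PVal-Take2Step-disjoint E D _ M _ (inj₂ (refl , refl)) (inj₁ (refl , od , _ , le)) (inj₁ (_ , od' , _)) = odd≢odd-suc D (trans od (sym od'))
PVal-Take2Step-disjoint E D _ M _ (inj₂ (refl , refl)) (inj₁ (refl , od , _ , le)) (inj₂ (inj₁ (() , _)))
PVal-Take2Step-disjoint E D _ M _ (inj₂ (refl , refl)) (inj₁ (refl , od , _ , le)) (inj₂ (inj₂ (_ , _ , _ , lt'))) = <⇒≱ lt' (odd≤double⇒< D M od le)
PVal-Take2Step-disjoint E D _ M _ (inj₂ (refl , refl)) (inj₂ (inj₁ (refl , _ , _))) (inj₁ (() , _))
PVal-Take2Step-disjoint E D _ M _ (inj₂ (refl , refl)) (inj₂ (inj₁ (refl , _ , _))) (inj₂ (inj₁ (_ , () , _)))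
PVal-Take2Step-disjoint E D _ M _ (inj₂ (refl , refl)) (inj₂ (inj₁ (refl , _ , _))) (inj₂ (inj₂ (() , _)))
PVal-Take2Step-disjoint E D _ M _ (inj₂ (refl , refl)) (inj₂ (inj₂ (refl , ev , _ , lt))) (inj₁ (_ , _ , _ , le')) = <⇒≱ lt (≤-trans (n≤1+n D) le')
PVal-Take2Step-disjoint E D _ M _ (inj₂ (refl , refl)) (inj₂ (inj₂ (refl , ev , _ , lt))) (inj₂ (inj₁ (() , _)))
PVal-Take2Step-disjoint E D _ M _ (inj₂ (refl , refl)) (inj₂ (inj₂ (refl , ev , _ , lt))) (inj₂ (inj₂ (_ , ev' , _))) = odd≢odd-suc D (trans ev (sym ev'))

take1-small : ∀ r ey → bDeg (heapVal (2 + r)) ≡ 0 → aBit (heapVal (2 + r)) xor ey ≡ true → ¬ PVal (heapVal (1 + r) · ⟨ ey , 0 , 0 ⟩)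
take1-small 0 false _ _ = toWitnessFalse {a? = PVal? _} tt
take1-small 0 true _ ()
take1-small 1 false () _
take1-small 1 true () _
take1-small 2 false () _
take1-small 2 true () _
take1-small 3 false _ ()
take1-small 3 true _ _ = toWitnessFalse {a? = PVal? _} tt
take1-small 4 false _ _ = toWitnessFalse {a? = PVal? _} tt
take1-small 4 true _ ()
take1-small 5 false () _
take1-small 5 true () _
take1-small 6 false () _
take1-small 6 true () _
take1-small 7 false () _
take1-small 7 true () _
take1-small 8 false () _
take1-small 8 true () _
take1-small 9 false () _
take1-small 9 true () _
take1-small 10 false () _
take1-small 10 true () _
take1-small (suc (suc (suc (suc (suc (suc (suc (suc (suc (suc (suc r))))))))))) ey () _

split-small : ∀ a b ey → bDeg (heapVal (suc a)) ≡ 0 → bDeg (heapVal (suc b)) ≡ 0 →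
  aBit (heapVal (2 + (suc a + suc b))) xor ey ≡ false → ¬ PVal (heapVal (2 + (suc a + suc b)) · ⟨ ey , 0 , 0 ⟩)
split-small 0 0 false _ _ ()
split-small 0 0 true _ _ _ = toWitnessFalse {a? = PVal? _} tt
split-small 0 1 false _ _ _ = toWitnessFalse {a? = PVal? _} tt
split-small 0 1 true _ _ ()
split-small 0 2 false _ () _
split-small 0 2 true _ () _
split-small 0 3 false _ () _
split-small 0 3 true _ () _
split-small 0 4 false _ _ ()
split-small 0 4 true _ _ _ = toWitnessFalse {a? = PVal? _} tt
split-small 0 5 false _ _ _ = toWitnessFalse {a? = PVal? _} tt
split-small 0 5 true _ _ ()
split-small 0 (suc (suc (suc (suc (suc (suc b)))))) ey _ db _ = ⊥-elim (bDeg-heapVal-7+≢0 b db)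
split-small 1 0 false _ _ _ = toWitnessFalse {a? = PVal? _} tt
split-small 1 0 true _ _ ()
split-small 1 1 false _ _ ()
split-small 1 1 true _ _ _ = toWitnessFalse {a? = PVal? _} tt
split-small 1 2 false _ () _
split-small 1 2 true _ () _
split-small 1 3 false _ () _
split-small 1 3 true _ () _
split-small 1 4 false _ _ _ = toWitnessFalse {a? = PVal? _} tt
split-small 1 4 true _ _ ()
split-small 1 5 false _ _ ()
split-small 1 5 true _ _ _ = toWitnessFalse {a? = PVal? _} tt
split-small 1 (suc (suc (suc (suc (suc (suc b)))))) ey _ db _ = ⊥-elim (bDeg-heapVal-7+≢0 b db)
split-small 2 0 false () _ _
split-small 2 0 true () _ _
split-small 2 1 false () _ _
split-small 2 1 true () _ _
split-small 2 2 false () _ _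
split-small 2 2 true () _ _
split-small 2 3 false () _ _
split-small 2 3 true () _ _
split-small 2 4 false () _ _
split-small 2 4 true () _ _
split-small 2 5 false () _ _
split-small 2 5 true () _ _
split-small 2 (suc (suc (suc (suc (suc (suc b)))))) ey _ db _ = ⊥-elim (bDeg-heapVal-7+≢0 b db)
split-small 3 0 false () _ _
split-small 3 0 true () _ _
split-small 3 1 false () _ _
split-small 3 1 true () _ _
split-small 3 2 false () _ _
split-small 3 2 true () _ _
split-small 3 3 false () _ _
split-small 3 3 true () _ _
split-small 3 4 false () _ _
split-small 3 4 true () _ _
split-small 3 5 false () _ _
split-small 3 5 true () _ _
split-small 3 (suc (suc (suc (suc (suc (suc b)))))) ey _ db _ = ⊥-elim (bDeg-heapVal-7+≢0 b db)
split-small 4 0 false _ _ ()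
split-small 4 0 true _ _ _ = toWitnessFalse {a? = PVal? _} tt
split-small 4 1 false _ _ _ = toWitnessFalse {a? = PVal? _} tt
split-small 4 1 true _ _ ()
split-small 4 2 false _ () _
split-small 4 2 true _ () _
split-small 4 3 false _ () _
split-small 4 3 true _ () _
split-small 4 4 false _ _ ()
split-small 4 4 true _ _ _ = toWitnessFalse {a? = PVal? _} tt
split-small 4 5 false _ _ _ = toWitnessFalse {a? = PVal? _} tt
split-small 4 5 true _ _ ()
split-small 4 (suc (suc (suc (suc (suc (suc b)))))) ey _ db _ = ⊥-elim (bDeg-heapVal-7+≢0 b db)
split-small 5 0 false _ _ _ = toWitnessFalse {a? = PVal? _} tt
split-small 5 0 true _ _ ()
split-small 5 1 false _ _ ()
split-small 5 1 true _ _ _ = toWitnessFalse {a? = PVal? _} tt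
split-small 5 2 false _ () _
split-small 5 2 true _ () _
split-small 5 3 false _ () _
split-small 5 3 true _ () _
split-small 5 4 false _ _ _ = toWitnessFalse {a? = PVal? _} tt
split-small 5 4 true _ _ ()
split-small 5 5 false _ _ ()
split-small 5 5 true _ _ _ = toWitnessFalse {a? = PVal? _} tt
split-small 5 (suc (suc (suc (suc (suc (suc b)))))) ey _ db _ = ⊥-elim (bDeg-heapVal-7+≢0 b db)
split-small (suc (suc (suc (suc (suc (suc a)))))) b ey da _ _ = ⊥-elim (bDeg-heapVal-7+≢0 a da)

split-small-PA : ∀ a b ey → bDeg (heapVal (2 + (suc a + suc b))) ≡ 0 → aBit (heapVal (2 + (suc a + suc b))) xor ey ≡ true →
  ¬ PVal ((heapVal (suc a) · heapVal (suc b)) · ⟨ ey , 0 , 0 ⟩)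
split-small-PA 0 0 false () _
split-small-PA 0 0 true () _
split-small-PA 0 1 false _ ()
split-small-PA 0 1 true _ _ = toWitnessFalse {a? = PVal? _} tt
split-small-PA 0 2 false _ _ = toWitnessFalse {a? = PVal? _} tt
split-small-PA 0 2 true _ ()
split-small-PA 0 (suc (suc (suc b))) ey d _ = ⊥-elim (bDeg-heapVal-7+≢0 b d)
split-small-PA 1 0 false _ ()
split-small-PA 1 0 true _ _ = toWitnessFalse {a? = PVal? _} tt
split-small-PA 1 1 false _ _ = toWitnessFalse {a? = PVal? _} tt
split-small-PA 1 1 true _ ()
split-small-PA 1 2 false () _
split-small-PA 1 2 true () _
split-small-PA 1 (suc (suc (suc b))) ey d _ = ⊥-elim (bDeg-heapVal-7+≢0 (suc b) d)
split-small-PA 2 0 false _ _ = toWitnessFalse {a? = PVal? _} tt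
split-small-PA 2 0 true _ ()
split-small-PA 2 1 false () _
split-small-PA 2 1 true () _
split-small-PA 2 2 false () _
split-small-PA 2 2 true () _
split-small-PA 2 (suc (suc (suc b))) ey d _ = ⊥-elim (bDeg-heapVal-7+≢0 (suc (suc b)) d)
split-small-PA 3 0 false () _
split-small-PA 3 0 true () _
split-small-PA 3 1 false () _
split-small-PA 3 1 true () _
split-small-PA 3 2 false () _
split-small-PA 3 2 true () _
split-small-PA 3 (suc (suc (suc b))) ey d _ = ⊥-elim (bDeg-heapVal-7+≢0 (suc (suc (suc b))) d)
split-small-PA (suc (suc (suc (suc a)))) b ey d _ = ⊥-elim (bDeg-heapVal-7+≢0 (a + suc b) d)

Take2Step-·ʳ : ∀ h o y → Take2Step h o → Take2Step (h · y) (o · y)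
Take2Step-·ʳ h o y (inj₁ (d≡ , o≤h , h≤1+o)) =
  inj₁ (cong (_+ bDeg y) d≡ , ⊔-monoˡ-≤ (cTop y) o≤h , ≤-trans (⊔-monoˡ-≤ (cTop y) h≤1+o) ([1+m]⊔n≤1+[m⊔n] (cTop o) (cTop y)))
Take2Step-·ʳ h o y (inj₂ (d≡ , m≡)) = inj₂ (cong (_+ bDeg y) d≡ , cong (_⊔ cTop y) m≡)

Take2Step-notP : ∀ h o y → aBit o ≡ aBit h → Take2Step h o → PVal (h · y) → ¬ PVal (o · y)
Take2Step-notP h o y a≡ step p p' =
  PVal-Take2Step-disjoint (aBit h xor aBit y) (bDeg h + bDeg y) (bDeg o + bDeg y) (cTop h ⊔ cTop y) (cTop o ⊔ cTop y)
    (Take2Step-·ʳ h o y step) p (subst (λ e → PVal ⟨ e xor aBit y , bDeg o + bDeg y , cTop o ⊔ cTop y ⟩) a≡ p')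

take1-notP : ∀ r y → PVal (heapVal (2 + r) · y) → ¬ PVal (heapVal (1 + r) · y)
take1-notP r ⟨ ey , dy , my ⟩ p p' = bool-cases (aBit h xor ey) flipped kept
  where
    y = ⟨ ey , dy , my ⟩
    h = heapVal (2 + r)
    o = heapVal (1 + r)
    o-flips : aBit o ≡ not (aBit h)
    o-flips = trans (aBit-heapVal (suc r)) (trans (cong not (odd-suc r)) (cong not (sym (aBit-heapVal (suc (suc r))))))
    flipped : aBit h xor ey ≡ false → ⊥
    flipped ex with flip-PVal⇒PA h o y o-flips ex p'
    ... | bDeg-o≡0 , refl , refl with PVal-aFalse (h · y) p ex
    ...   | inj₁ (_ , _ , 1≤m , _) = <⇒≱ (≤-trans (heapVal-wellFormed (2 + r) 1≤cTop-h) bDeg-h≤1) 1≤cTop-h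
      where
        1≤cTop-h : 1 ≤ cTop h
        1≤cTop-h = subst (1 ≤_) (⊔-identityʳ (cTop h)) 1≤m
        bDeg-h≤1 : bDeg h ≤ 1
        bDeg-h≤1 = subst (λ d → bDeg h ≤ suc d) bDeg-o≡0 (take1-bDeg≤ r)
    ...   | inj₂ (_ , _ , 2≤d , _) =
      <⇒≱ (s≤s (subst (_≤ 1) (sym (+-identityʳ (bDeg h))) (subst (λ d → bDeg h ≤ suc d) bDeg-o≡0 (take1-bDeg≤ r)))) 2≤d
    kept : aBit h xor ey ≡ true → ⊥
    kept ex with PVal-aTrue (h · y) p ex
    ... | _ , d≡0 , m≡0 with m+n≡0⇒n≡0 (bDeg h) d≡0 | m⊔n≡0⇒n≡0 (cTop h) my m≡0
    ... | refl | refl = take1-small r ey (m+n≡0⇒m≡0 (bDeg h) d≡0) ex p'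

take2-notP : ∀ r y → PVal (heapVal (3 + r) · y) → ¬ PVal (heapVal (1 + r) · y)
take2-notP r y = Take2Step-notP (heapVal (3 + r)) (heapVal (1 + r)) y
  (trans (aBit-heapVal (suc r)) (sym (aBit-heapVal (3 + r)))) (take2-step r)

split-notP : ∀ a b y → PVal (heapVal (2 + (suc a + suc b)) · y) → ¬ PVal ((heapVal (suc a) · heapVal (suc b)) · y)
split-notP a b ⟨ ey , dy , my ⟩ p p' = bool-cases (aBit h xor ey) flipped kept
  where
    y = ⟨ ey , dy , my ⟩
    h = heapVal (2 + (suc a + suc b))
    o = heapVal (suc a) · heapVal (suc b)
    o-flips : aBit o ≡ not (aBit h)
    o-flips = begin
      aBit (heapVal (suc a)) xor aBit (heapVal (suc b)) ≡⟨ cong₂ _xor_ (aBit-heapVal (suc a)) (aBit-heapVal (suc b)) ⟩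
      not (odd (suc a)) xor not (odd (suc b))           ≡⟨ not-xor-not (odd (suc a)) (odd (suc b)) ⟩
      odd (suc a) xor odd (suc b)                       ≡⟨ odd-+ (suc a) (suc b) ⟨
      odd (suc a + suc b)                               ≡⟨ not-involutive _ ⟨
      not (not (odd (2 + (suc a + suc b))))             ≡⟨ cong not (aBit-heapVal (2 + (suc a + suc b))) ⟨
      not (aBit h)                                      ∎
      where open ≡-Reasoning
    flipped : aBit h xor ey ≡ false → ⊥
    flipped ex with flip-PVal⇒PA h o y o-flips ex p'
    ... | d≡0 , refl , refl = split-small a b ey (m+n≡0⇒m≡0 (bDeg (heapVal (suc a))) d≡0) (m+n≡0⇒n≡0 (bDeg (heapVal (suc a))) d≡0) ex p
    kept : aBit h xor ey ≡ true → ⊥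
    kept ex with PVal-aTrue (h · y) p ex
    ... | _ , d≡0 , m≡0 with m+n≡0⇒n≡0 (bDeg h) d≡0 | m⊔n≡0⇒n≡0 (cTop h) my m≡0
    ... | refl | refl = split-small-PA a b ey (m+n≡0⇒m≡0 (bDeg h) d≡0) ex p'

P-move-notP : ∀ {k hs} y → HeapMove k hs → PVal (heapVal k · y) → ¬ PVal (val hs · y)
P-move-notP y (take1 r) p = take1-notP r y p ∘ subst (λ v → PVal (v · y)) (·-identityʳ (heapVal (1 + r)))
P-move-notP y (take2 r) p = take2-notP r y p ∘ subst (λ v → PVal (v · y)) (·-identityʳ (heapVal (1 + r)))
P-move-notP y (take2split a b) p = split-notP a b y p ∘ subst (λ v → PVal ((heapVal (suc a) · v) · y)) (·-identityʳ (heapVal (suc b)))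

BHeapMoves : ℕ → Set
BHeapMoves k = (Σ (List ℕ) λ hs → HeapMove k hs × val hs ≡ ⟨ not (aBit (heapVal k)) , 0 , 0 ⟩) ×
           (Σ (List ℕ) λ hs → HeapMove k hs × val hs ≡ ⟨ aBit (heapVal k) , 0 , 0 ⟩) × bDeg (heapVal k) ≡ 1

bHeap-moves : ∀ k → 1 ≤ k → cTop (heapVal k) ≡ 0 → 1 ≤ bDeg (heapVal k) → BHeapMoves k
bHeap-moves 0 () _ _
bHeap-moves 1 _ _ ()
bHeap-moves 2 _ _ ()
bHeap-moves 3 _ _ _ = (2 ∷ [] , take1 1 , refl) , (1 ∷ [] , take2 0 , refl) , refl
bHeap-moves 4 _ _ _ = (1 ∷ 1 ∷ [] , take2split 0 0 , refl) , (2 ∷ [] , take2 1 , refl) , refl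
bHeap-moves 5 _ _ ()
bHeap-moves 6 _ _ ()
bHeap-moves 7 _ _ _ = (6 ∷ [] , take1 5 , refl) , (5 ∷ [] , take2 4 , refl) , refl
bHeap-moves 8 _ _ _ = (1 ∷ 5 ∷ [] , take2split 0 4 , refl) , (6 ∷ [] , take2 5 , refl) , refl
bHeap-moves 9 _ () _
bHeap-moves 10 _ () _
bHeap-moves 11 _ () _
bHeap-moves 12 _ () _
bHeap-moves (suc (suc (suc (suc (suc (suc (suc (suc (suc (suc (suc (suc (suc k))))))))))))) _ () _

aHeap-flip : ∀ k → 2 ≤ k → bDeg (heapVal k) ≡ 0 → Σ (List ℕ) λ hs → HeapMove k hs × val hs ≡ ⟨ not (aBit (heapVal k)) , 0 , 0 ⟩
aHeap-flip 0 () _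
aHeap-flip 1 (s≤s ()) _
aHeap-flip 2 _ _ = 1 ∷ [] , take1 0 , refl
aHeap-flip 3 _ ()
aHeap-flip 4 _ ()
aHeap-flip 5 _ _ = 1 ∷ 2 ∷ [] , take2split 0 1 , refl
aHeap-flip 6 _ _ = 5 ∷ [] , take1 4 , refl
aHeap-flip 7 _ ()
aHeap-flip 8 _ ()
aHeap-flip 9 _ ()
aHeap-flip 10 _ ()
aHeap-flip 11 _ ()
aHeap-flip 12 _ ()
aHeap-flip (suc (suc (suc (suc (suc (suc (suc (suc (suc (suc (suc (suc (suc k))))))))))))) _ ()

-- Moves into 𝒫

GoodMove : ℕ → Val → Set
GoodMove h y = Σ (List ℕ) λ hs → HeapMove h hs × PVal (val hs · y)

goodMove₁ : ∀ {h} k y → HeapMove h (k ∷ []) → PVal (heapVal k · y) → GoodMove h y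
goodMove₁ k y mv p = k ∷ [] , mv , subst (λ z → PVal (z · y)) (sym (·-identityʳ (heapVal k))) p

goodMove₂ : ∀ {h} a b y → HeapMove h (a ∷ b ∷ []) → PVal ((heapVal a · heapVal b) · y) → GoodMove h y
goodMove₂ a b y mv p = a ∷ b ∷ [] , mv , subst (λ z → PVal ((heapVal a · z) · y)) (sym (·-identityʳ (heapVal b))) p

PBB-bound : ∀ n' dy my → WellFormed ⟨ true , dy , my ⟩ → my ≤ suc (suc n') → double (suc n') < 2 + n' + dy →
  double (suc n' ⊔ my) < 2 + n' + dy
PBB-bound n' dy my wf my≤ gt with my ≤? suc n'
... | yes le = subst (λ z → double z < 2 + n' + dy) (sym (m≥n⇒m⊔n≡m le)) gt
... | no nle2 = subst (λ z → double z < 2 + n' + dy) (sym (m≤n⇒m⊔n≡n (<⇒≤ (≰⇒> nle2))))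
      (subst (λ z → double z < 2 + n' + dy) (sym eqM) (double[2+n]<2+n+d n' dy (subst (_< dy) eqM (wf (subst (1 ≤_) (sym eqM) (s≤s z≤n))))))
  where
    eqM : my ≡ suc (suc n')
    eqM = ≤-antisym my≤ (≰⇒> nle2)

-- In the *-top-* lemmas the heap H_(9+2n), H_10 or H_(12+2n) carries the largest c-index of the
-- position, and y is the value of the remaining heaps, so cTop y ≤ n + 1.
even-top-a-withC : ∀ n dy my → 3 + n + dy ≤ double (suc n) → 3 + n + dy ≢ double (suc n) →
  odd (3 + n + dy) ≡ false → GoodMove (12 + double n) ⟨ true , dy , my ⟩
even-top-a-withC zero dy my le ne ev = ⊥-elim (3+≰2 le)
even-top-a-withC (suc n') dy my le ne ev = goodMove₁ (12 + double n') y (take2 (9 + double (suc n')))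
  (subst (λ z → PVal (z · y)) (sym (heapVal-even n'))
    (pbc refl (odd-pred (3 + n' + dy) ev) (≤-trans (s≤s z≤n) (m≤m⊔n (suc n') my))
      (≤-trans (≤-pred2 (≤∧≢⇒< le ne)) (double-mono (m≤m⊔n (suc n') my)))))
  where y = ⟨ true , dy , my ⟩

even-top-a-noC : ∀ n dy my → WellFormed ⟨ true , dy , my ⟩ → my ≤ suc n → ¬ (3 + n + dy ≤ double (suc n)) →
  odd (3 + n + dy) ≡ true → GoodMove (12 + double n) ⟨ true , dy , my ⟩
even-top-a-noC zero zero my wf my≤ nle od rewrite wellFormed-bDeg≡0 ⟨ true , 0 , my ⟩ wf refl =
  goodMove₂ 5 5 ⟨ true , 0 , 0 ⟩ (take2split 4 4) (inj₂ (inj₁ (refl , refl , refl)))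
even-top-a-noC zero (suc dy') my wf my≤ nle od = goodMove₁ 10 ⟨ true , suc dy' , my ⟩ (take2 9)
  (pbb refl (odd-pred (suc (suc (suc dy'))) od) (s≤s (s≤s z≤n))
    (subst (λ z → double z < 2 + suc dy') (sym (m≥n⇒m⊔n≡m my≤)) (s≤s (s≤s (s≤s z≤n)))))
even-top-a-noC (suc n') dy my wf my≤ nle od = goodMove₁ (12 + double n') y (take2 (9 + double (suc n')))
  (subst (λ z → PVal (z · y)) (sym (heapVal-even n'))
    (pbb refl (odd-pred (3 + n' + dy) od) (s≤s (s≤s z≤n))
      (≤-trans (PBB-bound n' dy my wf my≤ (≤-pred2 (≰⇒> nle))) (n≤1+n _))))
  where y = ⟨ true , dy , my ⟩

even-top-take1 : ∀ n dy my → my ≤ suc n → PVal ⟨ false , 3 + n + dy , suc (suc n) ⟩ → GoodMove (12 + double n) ⟨ false , dy , my ⟩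
even-top-take1 n dy my my≤ p = goodMove₁ (11 + double n) ⟨ false , dy , my ⟩ (take1 (10 + double n))
  (subst (λ z → PVal (z · ⟨ false , dy , my ⟩)) (sym (heapVal-odd (suc n)))
    (subst (λ z → PVal ⟨ false , 3 + n + dy , z ⟩) (sym (m≥n⇒m⊔n≡m (≤-trans my≤ (n≤1+n _)))) p))

even-top-split1 : ∀ n dy my → my ≤ suc n → PVal ⟨ false , 2 + n + dy , suc n ⟩ → GoodMove (12 + double n) ⟨ false , dy , my ⟩
even-top-split1 n dy my my≤ p = goodMove₂ 1 (9 + double n) ⟨ false , dy , my ⟩ (take2split 0 (8 + double n))
  (subst (λ z → PVal ((heapVal 1 · z) · ⟨ false , dy , my ⟩)) (sym (heapVal-odd n))
    (subst (λ z → PVal ⟨ false , 2 + n + dy , z ⟩) (sym (m≥n⇒m⊔n≡m my≤)) p))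

even-top-split2 : ∀ n dy my → WellFormed ⟨ false , dy , my ⟩ → my ≤ suc n → double (suc n) < 3 + n + dy →
  odd (3 + n + dy) ≡ false → ¬ (double (suc (suc n)) < 3 + n + dy) → GoodMove (12 + double n) ⟨ false , dy , my ⟩
even-top-split2 zero zero my wf my≤ gt ev sm = ⊥-elim (3+≰2 (≤-pred (even>double⇒2+≤ 3 1 ev gt)))
even-top-split2 zero (suc zero) zero wf my≤ gt ev sm = goodMove₂ 2 8 _ (take2split 1 7) (toWitness {a? = PVal? _} tt)
even-top-split2 zero (suc zero) (suc my) wf my≤ gt ev sm with wf (s≤s z≤n)
... | s≤s ()
even-top-split2 zero (suc (suc dy)) my wf my≤ gt ev sm = ⊥-elim (sm (s≤s (s≤s (s≤s (s≤s (s≤s z≤n))))))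
even-top-split2 (suc zero) zero my wf my≤ gt ev sm with even>double⇒2+≤ 4 2 ev gt
... | s≤s (s≤s (s≤s (s≤s ())))
even-top-split2 (suc zero) (suc zero) my wf my≤ gt ev sm with even>double⇒2+≤ 5 2 ev gt
... | s≤s (s≤s (s≤s (s≤s (s≤s ()))))
even-top-split2 (suc zero) (suc (suc zero)) zero wf my≤ gt ev sm = goodMove₂ 2 10 _ (take2split 1 9) (toWitness {a? = PVal? _} tt)
even-top-split2 (suc zero) (suc (suc zero)) (suc zero) wf my≤ gt ev sm = goodMove₂ 2 10 _ (take2split 1 9) (toWitness {a? = PVal? _} tt)
even-top-split2 (suc zero) (suc (suc zero)) (suc (suc my)) wf my≤ gt ev sm with wf (s≤s z≤n)
... | s≤s (s≤s ())
even-top-split2 (suc zero) (suc (suc (suc dy))) my wf my≤ gt ev sm = ⊥-elim (sm (s≤s (s≤s (s≤s (s≤s (s≤s (s≤s (s≤s z≤n))))))))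
even-top-split2 (suc (suc n'')) dy my wf my≤ gt ev sm =
  goodMove₂ 2 (12 + double n'') ⟨ false , dy , my ⟩ (take2split 1 (7 + double (suc (suc n''))))
    (subst (λ z → PVal ((heapVal 2 · z) · ⟨ false , dy , my ⟩)) (sym (heapVal-even n''))
      (pbb refl ev (s≤s (s≤s z≤n)) goal))
  where
    a1 : suc (suc (suc (double n''))) ≤ n'' + dy
    a1 with even>double⇒2+≤ _ _ ev gt
    ... | s≤s (s≤s (s≤s (s≤s (s≤s le)))) = le
    a2 : n'' + dy ≤ suc (suc (suc (double n'')))
    a2 with ≮⇒≥ sm
    ... | s≤s (s≤s (s≤s (s≤s (s≤s le)))) = le
    eq3 : n'' + suc (suc (suc n'')) ≡ suc (suc (suc (double n'')))
    eq3 = trans (+-suc n'' (suc (suc n''))) (cong suc (n+[2+n]≡double[1+n] n''))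
    dyle : dy ≤ suc (suc (suc n''))
    dyle = +-cancelˡ-≤ n'' dy (suc (suc (suc n''))) (subst (n'' + dy ≤_) (sym eq3) a2)
    myle2 : my ≤ suc (suc n'')
    myle2 = wellFormed-cTop≤ {false} my dy wf dyle
    goal : double (suc n'' ⊔ my) < 3 + n'' + dy
    goal = ≤-trans (s≤s (double-mono (⊔-lub (n≤1+n _) myle2))) (s≤s (s≤s (s≤s (≤-trans (n≤1+n _) a1))))

even-top-reply : ∀ n ey dy my → WellFormed ⟨ ey , dy , my ⟩ → my ≤ suc n →
  ¬ PVal ⟨ not ey , 3 + n + dy , suc n ⟩ →
  (ey ≡ true → 3 + n + dy ≤ double (suc n) → 3 + n + dy ≢ double (suc n)) →
  GoodMove (12 + double n) ⟨ ey , dy , my ⟩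
even-top-reply n true dy my wf my≤ ¬p not-tight = dec-cases (3 + n + dy ≤? double (suc n))
  (λ le → bool-cases (odd (3 + n + dy)) (even-top-a-withC n dy my le (not-tight refl le)) (λ od → ⊥-elim (¬p (pbc refl od (s≤s z≤n) le))))
  (λ nle → bool-cases (odd (3 + n + dy)) (λ ev → ⊥-elim (¬p (pbb refl ev (s≤s (s≤s z≤n)) (≰⇒> nle)))) (even-top-a-noC n dy my wf my≤ nle))
even-top-reply n false dy my wf my≤ ¬p not-tight = dec-cases (3 + n + dy ≤? double (suc n))
  (λ le → bool-cases (odd (3 + n + dy))
     (λ ev → even-top-split1 n dy my my≤ (pbc refl (odd-pred (2 + n + dy) ev) (s≤s z≤n) (≤-trans (n≤1+n _) le)))
     (λ od → even-top-take1 n dy my my≤ (pbc refl od (s≤s z≤n) (≤-trans le (double-mono (n≤1+n _))))))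
  (λ nle → bool-cases (odd (3 + n + dy))
     (λ ev → dec-cases (double (suc (suc n)) <? 3 + n + dy)
        (λ big → even-top-take1 n dy my my≤ (pbb refl ev (s≤s (s≤s z≤n)) big))
        (λ sm → even-top-split2 n dy my wf my≤ (≰⇒> nle) ev sm))
     (λ od → dec-cases (3 + n + dy ≟ suc (double (suc n)))
        (λ eq → even-top-take1 n dy my my≤ (pbc refl od (s≤s z≤n) (subst (_≤ double (suc (suc n))) (sym eq) (n≤1+n _))))
        (λ ne → even-top-split1 n dy my my≤ (pbb refl (odd-pred (2 + n + dy) od) (s≤s (s≤s z≤n))
                   (≤-pred (≤∧≢⇒< (≰⇒> nle) (λ e → ne (sym e))))))))

ten-top-bound : ∀ dy' my → WellFormed ⟨ true , suc dy' , my ⟩ → my ≤ 1 → double my < 2 + dy'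
ten-top-bound dy' zero wf my≤ = s≤s z≤n
ten-top-bound dy' (suc zero) wf my≤ with wf (s≤s z≤n)
... | s≤s (s≤s le) = s≤s (s≤s (s≤s le))
ten-top-bound dy' (suc (suc my)) wf (s≤s ())

ten-top-reply : ∀ ey dy my → WellFormed ⟨ ey , dy , my ⟩ → my ≤ 1 → ¬ PVal ⟨ not ey , 2 + dy , 1 ⟩ →
  (ey ≡ true → 2 + dy ≤ 2 → 2 + dy ≢ 2) → GoodMove 10 ⟨ ey , dy , my ⟩
ten-top-reply true zero my wf my≤ ¬p not-tight = ⊥-elim (not-tight refl ≤-refl refl)
ten-top-reply true (suc dy') my wf my≤ ¬p not-tight = bool-cases (odd (3 + dy'))
  (λ ev → ⊥-elim (¬p (pbb refl ev (s≤s (s≤s z≤n)) (s≤s (s≤s (s≤s z≤n))))))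
  (λ od → goodMove₁ 8 ⟨ true , suc dy' , my ⟩ (take2 7) (pbb refl (odd-pred (2 + dy') od) (s≤s (s≤s z≤n)) (ten-top-bound dy' my wf my≤)))
ten-top-reply false zero my wf my≤ ¬p not-tight rewrite wellFormed-bDeg≡0 ⟨ false , 0 , my ⟩ wf refl = goodMove₂ 4 4 _ (take2split 3 3) (toWitness {a? = PVal? _} tt)
ten-top-reply false (suc dy') my wf my≤ ¬p not-tight = bool-cases (odd (3 + dy'))
  (λ ev → goodMove₁ 9 ⟨ false , suc dy' , my ⟩ (take1 8)
    (subst (λ z → PVal ⟨ false , 3 + dy' , z ⟩) (sym (m≥n⇒m⊔n≡m my≤)) (pbb refl ev (s≤s (s≤s z≤n)) (s≤s (s≤s (s≤s z≤n))))))
  (λ od → goodMove₂ 1 7 ⟨ false , suc dy' , my ⟩ (take2split 0 6) (pbb refl (odd-pred (2 + dy') od) (s≤s (s≤s z≤n)) (ten-top-bound dy' my wf my≤)))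

odd-top-withC : ∀ n dy my → 2 + n + dy ≤ double (suc n) → 2 + n + dy ≢ double (suc n) →
  odd (2 + n + dy) ≡ false → GoodMove (9 + double n) ⟨ false , dy , my ⟩
odd-top-withC zero zero my le ne ev = ⊥-elim (ne refl)
odd-top-withC zero (suc dy) my le ne ev = ⊥-elim (3+≰2 le)
odd-top-withC (suc n') dy my le ne ev = goodMove₁ (9 + double n') y (take2 (6 + double (suc n')))
  (subst (λ z → PVal (z · y)) (sym (heapVal-odd n'))
    (pbc refl (odd-pred (2 + n' + dy) ev) (≤-trans (s≤s z≤n) (m≤m⊔n (suc n') my))
      (≤-trans (≤-pred2 (≤∧≢⇒< le ne)) (double-mono (m≤m⊔n (suc n') my)))))
  where y = ⟨ false , dy , my ⟩

odd-top-noC : ∀ n dy my → WellFormed ⟨ false , dy , my ⟩ → my ≤ suc n → ¬ (2 + n + dy ≤ double (suc n)) →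
  odd (2 + n + dy) ≡ true → GoodMove (9 + double n) ⟨ false , dy , my ⟩
odd-top-noC zero zero my wf my≤ nle od = ⊥-elim (nle ≤-refl)
odd-top-noC zero (suc dy') my wf my≤ nle od = goodMove₁ 7 ⟨ false , suc dy' , my ⟩ (take2 6)
  (pbb refl (odd-pred (2 + dy') od) (s≤s (s≤s z≤n)) (ten-top-bound dy' my wf my≤))
odd-top-noC (suc n') dy my wf my≤ nle od = goodMove₁ (9 + double n') y (take2 (6 + double (suc n')))
  (subst (λ z → PVal (z · y)) (sym (heapVal-odd n'))
    (pbb refl (odd-pred (2 + n' + dy) od) (s≤s (s≤s z≤n))
      (PBB-bound n' dy my wf my≤ (≤-trans (≤-pred2 (≰⇒> nle)) (n≤1+n _)))))
  where y = ⟨ false , dy , my ⟩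

odd-top-a-take1 : ∀ n dy my Mo → Mo ≤ n → WellFormed ⟨ true , dy , my ⟩ → my ≤ suc n → ¬ (2 + n + dy ≤ double (suc n)) →
  odd (2 + n + dy) ≡ true → PVal ⟨ false , suc n + dy , Mo ⊔ my ⟩
odd-top-a-take1 n dy my Mo mo wf my≤ nle od = pbb refl (odd-pred (suc n + dy) od) (s≤s (≤-trans (s≤s z≤n) gt')) bound
  where
    gt' : suc (double n) ≤ n + dy
    gt' = ≤-pred2 (≰⇒> nle)
    eq2 : n + suc (suc n) ≡ suc (suc (double n))
    eq2 = n+[2+n]≡double[1+n] n
    bound : double (Mo ⊔ my) < suc n + dy
    bound with my ≤? n
    ... | yes le = s≤s (≤-trans (double-mono (⊔-lub mo le)) (≤-trans (n≤1+n _) gt'))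
    ... | no nle2 = subst (λ z → double z < suc n + dy) (sym (trans (m≤n⇒m⊔n≡n (≤-trans mo (<⇒≤ (≰⇒> nle2)))) eqM))
          (s≤s (subst (_≤ n + dy) eq2 (+-monoʳ-≤ n (subst (_< dy) eqM (wf (subst (1 ≤_) (sym eqM) (s≤s z≤n)))))))
      where
        eqM : my ≡ suc n
        eqM = ≤-antisym my≤ (≰⇒> nle2)

odd-top-a-noC : ∀ n dy my → WellFormed ⟨ true , dy , my ⟩ → my ≤ suc n → ¬ (2 + n + dy ≤ double (suc n)) →
  odd (2 + n + dy) ≡ true → GoodMove (9 + double n) ⟨ true , dy , my ⟩
odd-top-a-noC zero dy my wf my≤ nle od = goodMove₁ 8 _ (take1 7) (odd-top-a-take1 0 dy my 0 z≤n wf my≤ nle od)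
odd-top-a-noC (suc zero) dy my wf my≤ nle od = goodMove₁ 10 _ (take1 9) (odd-top-a-take1 1 dy my 1 ≤-refl wf my≤ nle od)
odd-top-a-noC (suc (suc n'')) dy my wf my≤ nle od = goodMove₁ (12 + double n'') y (take1 (7 + double (suc (suc n''))))
  (subst (λ z → PVal (z · y)) (sym (heapVal-even n'')) (odd-top-a-take1 (suc (suc n'')) dy my (suc n'') (n≤1+n _) wf my≤ nle od))
  where y = ⟨ true , dy , my ⟩

odd-top-a-withC : ∀ n dy my → WellFormed ⟨ true , dy , my ⟩ → my ≤ suc n → 2 + n + dy ≤ double (suc n) →
  odd (2 + n + dy) ≡ false → GoodMove (9 + double n) ⟨ true , dy , my ⟩
odd-top-a-withC zero zero my wf my≤ le ev rewrite wellFormed-bDeg≡0 ⟨ true , 0 , my ⟩ wf refl = goodMove₂ 3 4 _ (take2split 2 3) (toWitness {a? = PVal? _} tt)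
odd-top-a-withC zero (suc dy) my wf my≤ le ev = ⊥-elim (3+≰2 le)
odd-top-a-withC (suc zero) zero my wf my≤ le ()
odd-top-a-withC (suc zero) (suc zero) zero wf my≤ le ev = goodMove₂ 1 8 _ (take2split 0 7) (toWitness {a? = PVal? _} tt)
odd-top-a-withC (suc zero) (suc zero) (suc my) wf my≤ le ev with wf (s≤s z≤n)
... | s≤s ()
odd-top-a-withC (suc zero) (suc (suc dy)) my wf my≤ (s≤s (s≤s (s≤s (s≤s ())))) ev
odd-top-a-withC (suc (suc zero)) zero my wf my≤ le ev rewrite wellFormed-bDeg≡0 ⟨ true , 0 , my ⟩ wf refl =
  goodMove₂ 3 8 _ (take2split 2 7) (toWitness {a? = PVal? _} tt)
odd-top-a-withC (suc (suc zero)) (suc zero) my wf my≤ le ()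
odd-top-a-withC (suc (suc zero)) (suc (suc zero)) zero wf my≤ le ev = goodMove₂ 1 10 _ (take2split 0 9) (toWitness {a? = PVal? _} tt)
odd-top-a-withC (suc (suc zero)) (suc (suc zero)) (suc zero) wf my≤ le ev = goodMove₂ 1 10 _ (take2split 0 9) (toWitness {a? = PVal? _} tt)
odd-top-a-withC (suc (suc zero)) (suc (suc zero)) (suc (suc my)) wf my≤ le ev with wf (s≤s z≤n)
... | s≤s (s≤s ())
odd-top-a-withC (suc (suc zero)) (suc (suc (suc dy))) my wf my≤ (s≤s (s≤s (s≤s (s≤s (s≤s (s≤s ())))))) ev
odd-top-a-withC (suc (suc (suc n3))) dy my wf my≤ le ev = dec-cases (suc n + dy ≤? double ((2 + n3) ⊔ my))
  (λ le1 → goodMove₁ (12 + double (suc n3)) y (take1 (7 + double n))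
     (subst (λ z → PVal (z · y)) (sym (heapVal-even (suc n3)))
       (pbc refl (odd-pred (suc n + dy) ev) (≤-trans (s≤s z≤n) (m≤m⊔n (2 + n3) my)) le1)))
  (λ nle1 → goodMove₂ 1 (12 + double n3) y (take2split 0 (5 + double n))
     (subst (λ z → PVal ((heapVal 1 · z) · y)) (sym (heapVal-even n3))
       (pbb refl ev (s≤s (s≤s z≤n)) (goal nle1))))
  where
    n = suc (suc (suc n3))
    y = ⟨ true , dy , my ⟩
    goal : ¬ (suc n + dy ≤ double ((2 + n3) ⊔ my)) → double (suc n3 ⊔ my) < 3 + n3 + dy
    goal nle1 with my ≤? suc n3
    ... | yes mle = subst (λ z → double z < 3 + n3 + dy) (sym (m≥n⇒m⊔n≡m mle))
          (s≤s (s≤s (s≤s (≤-trans (n≤1+n _) (≤-pred (≤-pred (≤-pred (≤-pred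
            (≰⇒> (subst (λ z → ¬ (suc n + dy ≤ double z)) (m≥n⇒m⊔n≡m (≤-trans mle (n≤1+n _))) nle1))))))))))
    ... | no mnle = subst (λ z → double z < 3 + n3 + dy) (sym (m≤n⇒m⊔n≡n (<⇒≤ (≰⇒> mnle))))
          (subst (_< n + dy) (sym (double≡+ my)) (+-mono-< (<-≤-trans myDy dyn) myDy))
      where
        myDy : my < dy
        myDy = wf (≤-trans (s≤s z≤n) (≰⇒> mnle))
        dyn : dy ≤ n
        dyn = +-cancelˡ-≤ n dy n (subst (n + dy ≤_) (double≡+ n) (≤-pred2 le))

odd-top-reply : ∀ n ey dy my → WellFormed ⟨ ey , dy , my ⟩ → my ≤ suc n →
  ¬ PVal ⟨ ey , 2 + n + dy , suc n ⟩ →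
  (ey ≡ false → 2 + n + dy ≤ double (suc n) → 2 + n + dy ≢ double (suc n)) →
  (ey ≡ true → (2 + n + dy ≤ double (suc n) → odd (2 + n + dy) ≡ false) × (¬ (2 + n + dy ≤ double (suc n)) → odd (2 + n + dy) ≡ true)) →
  GoodMove (9 + double n) ⟨ ey , dy , my ⟩
odd-top-reply n false dy my wf my≤ ¬p not-tight flip-notP = dec-cases (2 + n + dy ≤? double (suc n))
  (λ le → bool-cases (odd (2 + n + dy)) (odd-top-withC n dy my le (not-tight refl le)) (λ od → ⊥-elim (¬p (pbc refl od (s≤s z≤n) le))))
  (λ nle → bool-cases (odd (2 + n + dy)) (λ ev → ⊥-elim (¬p (pbb refl ev (s≤s (s≤s z≤n)) (≰⇒> nle)))) (odd-top-noC n dy my wf my≤ nle))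
odd-top-reply n true dy my wf my≤ ¬p not-tight flip-notP = dec-cases (2 + n + dy ≤? double (suc n))
  (λ le → odd-top-a-withC n dy my wf my≤ le (proj₁ (flip-notP refl) le))
  (λ nle → odd-top-a-noC n dy my wf my≤ nle (proj₂ (flip-notP refl) nle))

Win : List ℕ → Set
Win G = Σ (List ℕ) λ G' → Move G G' × PVal (val G')

win-fromGoodMove : ∀ {G h R} → Pick G h R → GoodMove h (val R) → Win G
win-fromGoodMove p (hs , mv , pv) with pick-move p mv
... | G' , m , eq = G' , m , subst PVal (sym eq) pv

-- The tight case aBit = false, bDeg = 2 cTop is treated by win-tight; FlipNotP v says that
-- flipping the a-bit of v (see aFlip) does not reach 𝒫.
NotTight FlipNotP : Val → Set
NotTight v = aBit v ≡ false → bDeg v ≤ double (cTop v) → bDeg v ≢ double (cTop v)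
FlipNotP v = aBit v ≡ true → (bDeg v ≤ double (cTop v) → odd (bDeg v) ≡ false) × (¬ (bDeg v ≤ double (cTop v)) → odd (bDeg v) ≡ true)

heapVal-even-· : ∀ n y → cTop y ≤ suc n → heapVal (12 + double n) · y ≡ ⟨ not (aBit y) , 3 + n + bDeg y , suc n ⟩
heapVal-even-· n y le rewrite heapVal-even n = cong (λ m → ⟨ not (aBit y) , 3 + n + bDeg y , m ⟩) (m≥n⇒m⊔n≡m le)

heapVal-odd-· : ∀ n y → cTop y ≤ suc n → heapVal (9 + double n) · y ≡ ⟨ aBit y , 2 + n + bDeg y , suc n ⟩
heapVal-odd-· n y le rewrite heapVal-odd n = cong (λ m → ⟨ aBit y , 2 + n + bDeg y , m ⟩) (m≥n⇒m⊔n≡m le)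

heapVal-10-· : ∀ y → cTop y ≤ 1 → heapVal 10 · y ≡ ⟨ not (aBit y) , 2 + bDeg y , 1 ⟩
heapVal-10-· y le = cong (λ m → ⟨ not (aBit y) , 2 + bDeg y , m ⟩) (m≥n⇒m⊔n≡m le)
win-evenTop : ∀ {G h R} → Pick G h R → 1 ≤ h → cTop (heapVal h) ≡ cTop (val G) → 1 ≤ cTop (val G) → aBit (heapVal h) ≡ true →
  ¬ PVal (val G) → NotTight (val G) → Win G
win-evenTop {G} {h} {R} p 1≤h top 1≤m ah ¬p not-tight with cHeap-cases h 1≤h (subst (1 ≤_) (sym top) 1≤m)
... | inj₁ (n , refl) with trans (sym ah) (cong aBit (heapVal-odd n))
...   | ()
win-evenTop {G} {h} {R} p 1≤h top 1≤m ah ¬p not-tight | inj₂ (inj₁ refl) =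
  win-fromGoodMove p (ten-top-reply (aBit y) (bDeg y) (cTop y) (val-wellFormed R) my≤ (subst (λ v → ¬ PVal v) G≡ ¬p)
    (λ t → subst NotTight G≡ not-tight (cong not t)))
  where
    y = val R
    my≤ : cTop y ≤ 1
    my≤ = subst (cTop y ≤_) (sym top) (proj₂ (pick-cTop≤ p))
    G≡ : val G ≡ ⟨ not (aBit y) , 2 + bDeg y , 1 ⟩
    G≡ = trans (pick-val p) (heapVal-10-· y my≤)
win-evenTop {G} {h} {R} p 1≤h top 1≤m ah ¬p not-tight | inj₂ (inj₂ (n , refl)) =
  win-fromGoodMove p (even-top-reply n (aBit y) (bDeg y) (cTop y) (val-wellFormed R) my≤ (subst (λ v → ¬ PVal v) G≡ ¬p)
    (λ t → subst NotTight G≡ not-tight (cong not t)))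
  where
    y = val R
    my≤ : cTop y ≤ suc n
    my≤ = subst (cTop y ≤_) (trans (sym top) (cong cTop (heapVal-even n))) (proj₂ (pick-cTop≤ p))
    G≡ : val G ≡ ⟨ not (aBit y) , 3 + n + bDeg y , suc n ⟩
    G≡ = trans (pick-val p) (heapVal-even-· n y my≤)

win-oddTop : ∀ {G h R} → Pick G h R → 1 ≤ h → cTop (heapVal h) ≡ cTop (val G) → 1 ≤ cTop (val G) → aBit (heapVal h) ≡ false →
  ¬ PVal (val G) → NotTight (val G) → FlipNotP (val G) → Win G
win-oddTop {G} {h} {R} p 1≤h top 1≤m ah ¬p not-tight flip-notP with cHeap-cases h 1≤h (subst (1 ≤_) (sym top) 1≤m)
... | inj₂ (inj₁ refl) with ah
...   | ()
win-oddTop {G} {h} {R} p 1≤h top 1≤m ah ¬p not-tight flip-notP | inj₂ (inj₂ (n , refl)) with trans (sym ah) (cong aBit (heapVal-even n))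
...   | ()
win-oddTop {G} {h} {R} p 1≤h top 1≤m ah ¬p not-tight flip-notP | inj₁ (n , refl) =
  win-fromGoodMove p (odd-top-reply n (aBit y) (bDeg y) (cTop y) (val-wellFormed R) my≤ (subst (λ v → ¬ PVal v) G≡ ¬p)
    (subst NotTight G≡ not-tight) (subst FlipNotP G≡ flip-notP))
  where
    y = val R
    my≤ : cTop y ≤ suc n
    my≤ = subst (cTop y ≤_) (trans (sym top) (cong cTop (heapVal-odd n))) (proj₂ (pick-cTop≤ p))
    G≡ : val G ≡ ⟨ aBit y , 2 + n + bDeg y , suc n ⟩
    G≡ = trans (pick-val p) (heapVal-odd-· n y my≤)

win-top : ∀ G → All (1 ≤_) G → 1 ≤ cTop (val G) → ¬ PVal (val G) → NotTight (val G) → FlipNotP (val G) → Win G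
win-top G pos 1≤m ¬p not-tight flip-notP with find-topHeap G 1≤m
... | h , R , p , top = bool-cases (aBit (heapVal h))
  (λ ah≡false → win-oddTop p (proj₁ (pick-All p pos)) top 1≤m ah≡false ¬p not-tight flip-notP)
  (λ ah≡true → win-evenTop p (proj₁ (pick-All p pos)) top 1≤m ah≡true ¬p not-tight)

AFlip : List ℕ → Set
AFlip G = Σ (List ℕ) λ G' → Move G G' × aBit (val G') ≡ false × bDeg (val G') ≡ bDeg (val G) × cTop (val G') ≡ cTop (val G)

aFlip : ∀ {G k R} → Pick G k R → 1 ≤ k → aBit (heapVal k) ≡ true → aBit (val G) ≡ true →
  (cTop (heapVal k) < cTop (val G)) ⊎ (cTop (val G) ≡ 0) → AFlip G
aFlip {k = zero} _ () _ _ _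
aFlip {k = suc zero} _ _ () _ _
aFlip {G} {suc (suc r)} {R} p _ ah a≡true top-cond with take1-aHeap r ah | pick-move p (take1 r)
... | ao≡false , do≡dh , mo≤ , mh≡0⇒mo≡0 | G' , mv , val≡ = G' , mv , a' , d' , m' top-cond
  where
    h = heapVal (2 + r)
    o = heapVal (1 + r)
    y = val R
    G≡ : val G ≡ h · y
    G≡ = pick-val p
    G'≡ : val G' ≡ o · y
    G'≡ = trans val≡ (cong (_· y) (·-identityʳ o))
    ay≡false : aBit y ≡ false
    ay≡false = not-injective (trans (cong (_xor aBit y) (sym ah)) (trans (cong aBit (sym G≡)) a≡true))
    a' : aBit (val G') ≡ false
    a' = trans (cong aBit G'≡) (trans (cong (_xor aBit y) ao≡false) ay≡false)
    d' : bDeg (val G') ≡ bDeg (val G)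
    d' = trans (cong bDeg G'≡) (trans (cong (_+ bDeg y) do≡dh) (cong bDeg (sym G≡)))
    mG≡ : cTop (val G) ≡ cTop h ⊔ cTop y
    mG≡ = cong cTop G≡
    y-on-top : cTop h < cTop (val G) → cTop (val G) ≡ cTop y
    y-on-top h<G with ≤-total (cTop y) (cTop h)
    ... | inj₁ y≤h = ⊥-elim (<-irrefl (sym (trans mG≡ (m≥n⇒m⊔n≡m y≤h))) h<G)
    ... | inj₂ h≤y = trans mG≡ (m≤n⇒m⊔n≡n h≤y)
    m' : (cTop h < cTop (val G)) ⊎ (cTop (val G) ≡ 0) → cTop (val G') ≡ cTop (val G)
    m' (inj₁ h<G) = trans (cong cTop G'≡)
      (trans (m≤n⇒m⊔n≡n (≤-trans mo≤ (subst (suc (cTop h) ≤_) (y-on-top h<G) h<G))) (sym (y-on-top h<G)))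
    m' (inj₂ mG≡0) = trans (cong cTop G'≡) (trans (cong₂ _⊔_ (mh≡0⇒mo≡0 (m⊔n≡0⇒m≡0 _ _ m≡0)) (m⊔n≡0⇒n≡0 _ _ m≡0)) (sym mG≡0))
      where
        m≡0 : cTop h ⊔ cTop y ≡ 0
        m≡0 = trans (sym mG≡) mG≡0

win-tight-noB : ∀ {G h R} → Pick G h R → 1 ≤ h → cTop (heapVal h) ≡ cTop (val G) → 1 ≤ cTop (val G) →
  aBit (val G) ≡ false → bDeg (val G) ≡ double (cTop (val G)) → bDeg (val R) ≡ 0 → Win G
win-tight-noB {G} {h} {R} p 1≤h top 1≤m a≡false d≡2m dy≡0 =
  cases (cHeap-cases h 1≤h (subst (1 ≤_) (sym top) 1≤m)) p a-hy d-hy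
  where
    y = val R
    a-hy : aBit (heapVal h) xor aBit y ≡ false
    a-hy = trans (sym (cong aBit (pick-val p))) a≡false
    d-hy : bDeg (heapVal h) + bDeg y ≡ double (cTop (heapVal h))
    d-hy = trans (sym (cong bDeg (pick-val p))) (trans d≡2m (cong double (sym top)))
    my≡0 : cTop y ≡ 0
    my≡0 = wellFormed-bDeg≡0 y (val-wellFormed R) dy≡0
    cases : ∀ {h'} → CHeap h' → Pick G h' R → aBit (heapVal h') xor aBit y ≡ false →
      bDeg (heapVal h') + bDeg y ≡ double (cTop (heapVal h')) → Win G
    cases (inj₁ (n , refl)) p' a' d' with 2+n≡double[1+n]⇒n≡0 n (subst (λ d → 2 + n + d ≡ double (suc n)) dy≡0
      (subst (λ w → bDeg w + bDeg y ≡ double (cTop w)) (heapVal-odd n) d'))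
    ... | refl = win-fromGoodMove p' (1 ∷ 6 ∷ [] , take2split 0 5 , pa _ (cong not a') dy≡0 my≡0)
    cases (inj₂ (inj₁ refl)) p' a' d' = win-fromGoodMove p' (2 ∷ 6 ∷ [] , take2split 1 5 , pa _ (not-injective a') dy≡0 my≡0)
    cases (inj₂ (inj₂ (n , refl))) p' a' d' with 3+n≡double[1+n]⇒n≡1 n (subst (λ d → 3 + n + d ≡ double (suc n)) dy≡0
      (subst (λ w → bDeg w + bDeg y ≡ double (cTop w)) (heapVal-even n) d'))
    ... | refl = win-fromGoodMove p' (6 ∷ 6 ∷ [] , take2split 5 5 , pa _ (not-injective a') dy≡0 my≡0)

-- Taking two beans from a heap with a b-part lowers bDeg to the odd number 2 cTop - 1.
take2-tight : ∀ {G k R} → Pick G k R → 1 ≤ k → 1 ≤ bDeg (heapVal k) → cTop (val R) ≡ cTop (val G) → 1 ≤ cTop (val G) →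
  aBit (val G) ≡ false → bDeg (val G) ≡ double (cTop (val G)) → Win G
take2-tight {k = 0} _ () _
take2-tight {k = 1} _ _ ()
take2-tight {k = 2} _ _ ()
take2-tight {G} {suc (suc (suc r))} {R} p _ 1≤dk mR≡m 1≤m a≡false d≡2m with take2-bHeap r 1≤dk | pick-move p (take2 r)
... | a-same , d-drop , mo≤ | G' , mv , val≡ = G' , mv , subst PVal (sym val-G'≡) target
  where
    o = heapVal (suc r)
    z = val R
    m = cTop (val G)
    m' = pred m
    m≡suc-m' : m ≡ suc m'
    m≡suc-m' = sym (suc-pred m {{>-nonZero 1≤m}})
    G≡ : val G ≡ heapVal (3 + r) · z
    G≡ = pick-val p
    o≤z : cTop o ≤ cTop z
    o≤z = subst (cTop o ≤_) (sym mR≡m) (≤-trans mo≤ (proj₁ (pick-cTop≤ p)))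
    target : PVal ⟨ false , suc (double m') , suc m' ⟩
    target = pbc refl (trans (odd-suc (double m')) (cong not (odd-double m'))) (s≤s z≤n) (n≤1+n _)
    val-G'≡ : val G' ≡ ⟨ false , suc (double m') , suc m' ⟩
    val-G'≡ = trans val≡ (trans (cong (_· z) (·-identityʳ o)) (Val-≡
      (trans (cong (_xor aBit z) a-same) (trans (cong aBit (sym G≡)) a≡false))
      (suc-injective (trans (cong (_+ bDeg z) (sym d-drop)) (trans (cong bDeg (sym G≡)) (trans d≡2m (cong double m≡suc-m')))))
      (trans (m≤n⇒m⊔n≡n o≤z) (trans mR≡m m≡suc-m'))))

win-tight-withB : ∀ {G h R} → All (1 ≤_) G → Pick G h R → cTop (heapVal h) ≡ cTop (val G) → 1 ≤ cTop (val G) →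
  aBit (val G) ≡ false → bDeg (val G) ≡ double (cTop (val G)) → 1 ≤ bDeg (val R) → Win G
win-tight-withB {G} {h} {R} pos p top 1≤m a≡false d≡2m 1≤dy with find-bHeap R 1≤dy
... | k , R' , q , 1≤dk with pick-pick p q
...   | R'' , p'' , R''≡ = take2-tight p'' (proj₁ (pick-All p'' pos)) 1≤dk cTop-R''≡ 1≤m a≡false d≡2m
  where
    cTop-R''≡ : cTop (val R'') ≡ cTop (val G)
    cTop-R''≡ = trans (cong cTop R''≡)
      (trans (m≥n⇒m⊔n≡m (≤-trans (proj₂ (pick-cTop≤ q)) (subst (cTop (val R) ≤_) (sym top) (proj₂ (pick-cTop≤ p))))) top)

win-tight : ∀ G → All (1 ≤_) G → 1 ≤ cTop (val G) → aBit (val G) ≡ false → bDeg (val G) ≡ double (cTop (val G)) → Win G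
win-tight G pos 1≤m a≡false d≡2m with find-topHeap G 1≤m
... | h , R , p , top = dec-cases (bDeg (val R) ≟ 0)
  (win-tight-noB p (proj₁ (pick-All p pos)) top 1≤m a≡false d≡2m)
  (win-tight-withB pos p top 1≤m a≡false d≡2m ∘ n≢0⇒n>0)

win-noC-noB : ∀ {G k R} → Pick G k R → 2 ≤ k → aBit (val G) ≡ false → bDeg (val G) ≡ 0 → cTop (val G) ≡ 0 → Win G
win-noC-noB {G} {k} {R} p 2≤k a≡false d≡0 m≡0 = reply (aHeap-flip k 2≤k (m+n≡0⇒m≡0 (bDeg (heapVal k)) d-ky≡0))
  where
    y = val R
    d-ky≡0 : bDeg (heapVal k) + bDeg y ≡ 0
    d-ky≡0 = trans (sym (cong bDeg (pick-val p))) d≡0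
    m-y≡0 : cTop y ≡ 0
    m-y≡0 = m⊔n≡0⇒n≡0 (cTop (heapVal k)) (cTop y) (trans (sym (cong cTop (pick-val p))) m≡0)
    a-flipped : not (aBit (heapVal k)) xor aBit y ≡ true
    a-flipped = trans (sym (not-distribˡ-xor (aBit (heapVal k)) (aBit y))) (cong not (trans (sym (cong aBit (pick-val p))) a≡false))
    reply : (Σ (List ℕ) λ hs → HeapMove k hs × val hs ≡ ⟨ not (aBit (heapVal k)) , 0 , 0 ⟩) → Win G
    reply (hs , mv , hs≡) = win-fromGoodMove p
      (hs , mv , subst (λ w → PVal (w · y)) (sym hs≡) (pa _ a-flipped (m+n≡0⇒n≡0 (bDeg (heapVal k)) d-ky≡0) m-y≡0))

win-noC-evenB : ∀ G → All (1 ≤_) G → aBit (val G) ≡ true → bDeg (val G) ≢ 0 → odd (bDeg (val G)) ≡ false → cTop (val G) ≡ 0 → Win G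
win-noC-evenB G pos a≡true d≢0 ev m≡0 with find-aHeap G a≡true
... | k , R , p , ak with aFlip p (proj₁ (pick-All p pos)) ak a≡true (inj₂ m≡0)
...   | G' , mv , a' , d' , m' = G' , mv ,
  pbb a' (trans (cong odd d') ev) (subst (2 ≤_) (sym d') (even≢0⇒2≤ _ d≢0 ev))
    (subst₂ (λ m d → double m < d) (sym (trans m' m≡0)) (sym d') (n≢0⇒n>0 d≢0))

-- A pure-b heap with cTop 0 is H_3, H_4, H_7 or H_8, which has moves to both a^0 and a^1.
win-noC-oddB : ∀ G → All (1 ≤_) G → bDeg (val G) ≢ 0 → odd (bDeg (val G)) ≡ true → cTop (val G) ≡ 0 → Win G
win-noC-oddB G pos d≢0 od m≡0 with find-bHeap G (n≢0⇒n>0 d≢0)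
... | k , R , p , 1≤dk with bHeap-moves k (proj₁ (pick-All p pos)) mk≡0 1≤dk
  where
    mk≡0 : cTop (heapVal k) ≡ 0
    mk≡0 = m⊔n≡0⇒m≡0 (cTop (heapVal k)) (cTop (val R)) (trans (sym (cong cTop (pick-val p))) m≡0)
... | (hs₁ , mv₁ , hs₁≡) , (hs₂ , mv₂ , hs₂≡) , dk≡1 = dec-cases (bDeg y ≟ 0) y-noB y-withB
  where
    y = val R
    ak = aBit (heapVal k)
    my≡0 : cTop y ≡ 0
    my≡0 = m⊔n≡0⇒n≡0 (cTop (heapVal k)) (cTop y) (trans (sym (cong cTop (pick-val p))) m≡0)
    a≡ : ak xor aBit y ≡ aBit (val G)
    a≡ = sym (cong aBit (pick-val p))
    flip-a : ∀ {b} → aBit (val G) ≡ b → not ak xor aBit y ≡ not b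
    flip-a eq = trans (sym (not-distribˡ-xor ak (aBit y))) (cong not (trans a≡ eq))
    d≡ : suc (bDeg y) ≡ bDeg (val G)
    d≡ = trans (cong (_+ bDeg y) (sym dk≡1)) (sym (cong bDeg (pick-val p)))
    flipping : PVal (⟨ not ak , 0 , 0 ⟩ · y) → Win G
    flipping pv = win-fromGoodMove p (hs₁ , mv₁ , subst (λ w → PVal (w · y)) (sym hs₁≡) pv)
    keeping : PVal (⟨ ak , 0 , 0 ⟩ · y) → Win G
    keeping pv = win-fromGoodMove p (hs₂ , mv₂ , subst (λ w → PVal (w · y)) (sym hs₂≡) pv)
    y-noB : bDeg y ≡ 0 → Win G
    y-noB dy≡0 = bool-cases (aBit (val G))
      (λ a≡false → flipping (pa _ (flip-a a≡false) dy≡0 my≡0))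
      (λ a≡true → keeping (pa _ (trans a≡ a≡true) dy≡0 my≡0))
    y-withB : bDeg y ≢ 0 → Win G
    y-withB dy≢0 = bool-cases (aBit (val G))
      (λ a≡false → keeping (pbb (trans a≡ a≡false) ev-y (even≢0⇒2≤ _ dy≢0 ev-y) 0<dy))
      (λ a≡true → flipping (pbb (flip-a a≡true) ev-y (even≢0⇒2≤ _ dy≢0 ev-y) 0<dy))
      where
        ev-y : odd (bDeg y) ≡ false
        ev-y = odd-pred (bDeg y) (trans (cong odd d≡) od)
        0<dy : double (cTop (⟨ false , 0 , 0 ⟩ · y)) < bDeg (⟨ false , 0 , 0 ⟩ · y)
        0<dy = subst (λ m → double m < bDeg y) (sym my≡0) (n≢0⇒n>0 dy≢0)

win-noC : ∀ G → All (1 ≤_) G → ¬ PVal (val G) → PickSuch G (2 ≤_) → cTop (val G) ≡ 0 → Win G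
win-noC G pos ¬p (k , R , p , 2≤k) m≡0 = dec-cases (bDeg (val G) ≟ 0) noB withB
  where
    noB : bDeg (val G) ≡ 0 → Win G
    noB d≡0 = bool-cases (aBit (val G)) (λ a≡false → win-noC-noB p 2≤k a≡false d≡0 m≡0) (λ a≡true → ⊥-elim (¬p (pa (val G) a≡true d≡0 m≡0)))
    withB : bDeg (val G) ≢ 0 → Win G
    withB d≢0 = bool-cases (odd (bDeg (val G)))
      (λ ev → bool-cases (aBit (val G))
        (λ a≡false → ⊥-elim (¬p (pbb a≡false ev (even≢0⇒2≤ _ d≢0 ev) (subst (λ m → double m < bDeg (val G)) (sym m≡0) (n≢0⇒n>0 d≢0)))))
        (λ a≡true → win-noC-evenB G pos a≡true d≢0 ev m≡0))
      (λ od → win-noC-oddB G pos d≢0 od m≡0)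

win-aFlip : ∀ G → All (1 ≤_) G → ¬ PVal (val G) → 1 ≤ cTop (val G) → aBit (val G) ≡ true →
  PVal ⟨ false , bDeg (val G) , cTop (val G) ⟩ → Win G
win-aFlip G pos ¬p 1≤m a≡true flipped with find-aHeap G a≡true
... | k , R , p , ak with cTop (heapVal k) ≟ cTop (val G)
...   | yes top = win-evenTop p (proj₁ (pick-All p pos)) top 1≤m ak ¬p (λ a≡false → ⊥-elim (not-¬ a≡true a≡false))
...   | no ¬top with aFlip p (proj₁ (pick-All p pos)) ak a≡true (inj₁ (≤∧≢⇒< (proj₁ (pick-cTop≤ p)) ¬top))
...     | G' , mv , a' , d' , m' = G' , mv , subst PVal (sym (Val-≡ a' d' m')) flipped

win-withC : ∀ G → All (1 ≤_) G → ¬ PVal (val G) → 1 ≤ cTop (val G) → Win G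
win-withC G pos ¬p 1≤m = bool-cases (aBit x) a-false a-true
  where
    x = val G
    a-true : aBit x ≡ true → Win G
    a-true a≡true = dec-cases (bDeg x ≤? double (cTop x))
      (λ le → bool-cases (odd (bDeg x))
        (λ ev → win-top G pos 1≤m ¬p (λ a≡false → ⊥-elim (not-¬ a≡true a≡false)) (λ _ → (λ _ → ev) , (λ nle → ⊥-elim (nle le))))
        (λ od → win-aFlip G pos ¬p 1≤m a≡true (pbc refl od 1≤m le)))
      (λ nle → bool-cases (odd (bDeg x))
        (λ ev → win-aFlip G pos ¬p 1≤m a≡true (pbb refl ev (≤-trans (double-mono 1≤m) (<⇒≤ (≰⇒> nle))) (≰⇒> nle)))
        (λ od → win-top G pos 1≤m ¬p (λ a≡false → ⊥-elim (not-¬ a≡true a≡false)) (λ _ → (λ le → ⊥-elim (nle le)) , (λ _ → od))))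
    a-false : aBit x ≡ false → Win G
    a-false a≡false = dec-cases (bDeg x ≤? double (cTop x))
      (λ le → dec-cases (bDeg x ≟ double (cTop x))
        (win-tight G pos 1≤m a≡false)
        (λ ne → win-top G pos 1≤m ¬p (λ _ _ → ne) (λ a≡true → ⊥-elim (not-¬ a≡false a≡true))))
      (λ nle → win-top G pos 1≤m ¬p (λ _ le → ⊥-elim (nle le)) (λ a≡true → ⊥-elim (not-¬ a≡false a≡true)))

win-notP : ∀ G → All (1 ≤_) G → ¬ PVal (val G) → PickSuch G (2 ≤_) → Win G
win-notP G pos ¬p big = dec-cases (cTop (val G) ≟ 0) (win-noC G pos ¬p big) (win-withC G pos ¬p ∘ n≢0⇒n>0)

-- Classification of positions

IsP⇒¬IsN : ∀ {G} → IsP G → ¬ IsN G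
IsP⇒¬IsN (isP (_ , mv) _) (noMove stuck) = stuck mv
IsP⇒¬IsN (isP _ allN) (toP mv p) = IsP⇒¬IsN p (allN mv)

heapMove-sum< : ∀ {k hs} → HeapMove k hs → sum hs < k
heapMove-sum< (take1 r) = s≤s (s≤s (≤-reflexive (+-identityʳ r)))
heapMove-sum< (take2 r) = s≤s (s≤s (≤-trans (≤-reflexive (+-identityʳ r)) (n≤1+n r)))
heapMove-sum< (take2split a b) = s≤s (s≤s (≤-trans (≤-reflexive (cong (a +_) (+-identityʳ (suc b)))) (n≤1+n _)))

move-sum< : ∀ {G G'} → Move G G' → sum G' < sum G
move-sum< (here {k} {hs} {G} m) = subst (λ s → suc s ≤ k + sum G) (sym (sum-++ hs G)) (+-monoˡ-≤ (sum G) (heapMove-sum< m))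
move-sum< (there {k} {G} {G'} mv) = subst (_≤ k + sum G) (+-suc k (sum G')) (+-monoʳ-≤ k (move-sum< mv))

heapMove-nonempty : ∀ {k hs} → HeapMove k hs → All (1 ≤_) hs
heapMove-nonempty (take1 r) = s≤s z≤n ∷ []
heapMove-nonempty (take2 r) = s≤s z≤n ∷ []
heapMove-nonempty (take2split a b) = s≤s z≤n ∷ s≤s z≤n ∷ []

move-nonempty : ∀ {G G'} → Move G G' → All (1 ≤_) G → All (1 ≤_) G'
move-nonempty (here m) (_ ∷ pos) = All.++⁺ (heapMove-nonempty m) pos
move-nonempty (there mv) (px ∷ pos) = px ∷ move-nonempty mv pos

allOnes⊎pick≥2 : ∀ G → All (1 ≤_) G → All (_≡ 1) G ⊎ PickSuch G (2 ≤_)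
allOnes⊎pick≥2 [] [] = inj₁ []
allOnes⊎pick≥2 (k ∷ G) (1≤k ∷ pos) with k ≟ 1
... | no k≢1 = inj₂ (k , G , here , ≤∧≢⇒< 1≤k (k≢1 ∘ sym))
... | yes k≡1 with allOnes⊎pick≥2 G pos
...   | inj₁ ones = inj₁ (k≡1 ∷ ones)
...   | inj₂ (k' , R , p , 2≤k') = inj₂ (k' , k ∷ R , there p , 2≤k')

allOnes-noMove : ∀ {G G'} → All (_≡ 1) G → ¬ Move G G'
allOnes-noMove (refl ∷ _) (here ())
allOnes-noMove (_ ∷ ones) (there mv) = allOnes-noMove ones mv

allOnes-val : ∀ {G} → All (_≡ 1) G → val G ≡ 𝟙
allOnes-val [] = refl
allOnes-val (refl ∷ ones) rewrite allOnes-val ones = refl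

P-options-notP : ∀ {G G'} → PVal (val G) → Move G G' → ¬ PVal (val G')
P-options-notP p mv p' with move-pick mv
... | k , hs , R , pk , hm , val≡ = P-move-notP (val R) hm (subst PVal (pick-val pk) p) (subst PVal val≡ p')

classify : ∀ n G → sum G ≤ n → All (1 ≤_) G → (PVal (val G) → IsP G) × (¬ PVal (val G) → IsN G)
classify zero [] _ _ = (λ p → ⊥-elim (¬PVal-𝟙 p)) , (λ _ → noMove (λ ()))
classify zero (k ∷ G) sum≤0 (1≤k ∷ _) = ⊥-elim (<⇒≱ (≤-trans 1≤k (m≤m+n k (sum G))) sum≤0)
classify (suc n) G sum≤n pos = toIsP , toIsN
  where
    ih : ∀ {G'} → Move G G' → (PVal (val G') → IsP G') × (¬ PVal (val G') → IsN G')
    ih mv = classify n _ (≤-pred (≤-trans (move-sum< mv) sum≤n)) (move-nonempty mv pos)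
    toIsP : PVal (val G) → IsP G
    toIsP p with allOnes⊎pick≥2 G pos
    ... | inj₁ ones = ⊥-elim (¬PVal-𝟙 (subst PVal (allOnes-val ones) p))
    ... | inj₂ (suc zero , _ , _ , s≤s ())
    ... | inj₂ (suc (suc r) , _ , pk , _) = isP (_ , proj₁ (proj₂ (pick-move pk (take1 r))))
      (λ mv → proj₂ (ih mv) (P-options-notP p mv))
    toIsN : ¬ PVal (val G) → IsN G
    toIsN ¬p with allOnes⊎pick≥2 G pos
    ... | inj₁ ones = noMove (allOnes-noMove ones)
    ... | inj₂ big with win-notP G pos ¬p big
    ...   | _ , mv , p' = toP mv (proj₁ (ih mv) p')

IsP⇔PVal : ∀ G → All (1 ≤_) G → IsP G ⇔ PVal (val G)
IsP⇔PVal G pos = mk⇔ to (proj₁ classified)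
  where
    classified = classify (sum G) G ≤-refl pos
    to : IsP G → PVal (val G)
    to isp with PVal? (val G)
    ... | yes p = p
    ... | no ¬p = ⊥-elim (IsP⇒¬IsN isp (proj₂ classified ¬p))

mainTheorem1 : (G : Position) → All (λ k → 1 ≤ k) G → (IsP G ⇔ InPSet (Φ G))
mainTheorem1 G pos = ⇔.trans (IsP⇔PVal G pos)
  (⇔.sym (subst (λ v → InPSet (Φ G) ⇔ PVal v) (wordVal-Φ G) (InPSet⇔PVal (Φ G))))
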